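{- Let $n$ be a sufficiently large positive integer and $m$ an integer with $n^{6}\le m\le n^{C}$ for a fixed constant $C$. Then $M_{\mathsf{SH}}(m,n)\le \mathcal{O}(\sqrt{n\log\log n})$.
   Context: $[N]=\{0,\dots,N-1\}$; $\mathfrak{m}_m(x)$ is the unique element of $(x+m\mathbb{Z})\cap[0,m)$; $\mathbb{Z}_m^{\times}$ is the set of $k\in[m]$ coprime to $m$. Smart linear hashing $\mathsf{SH}_m$ into $n$ bins: choose $a$ uniformly from $\mathbb{Z}_m^{\times}$ and place $x\in[m]$ in bin $\lfloor\mathfrak{m}_m(ax)/(m/n)\rfloor$. The maxload on $X$ is the number of elements of $X$ in the fullest bin; $M_{\mathsf{SH}}(m,n)$ is the maximum over $n$-element $X\subset[m]$ of the expected maxload of $\mathsf{SH}_m$ on $X$. -}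

module Defs where

open import Data.Nat using (ℕ; zero; suc; _+_; _*_; _⊔_; _≟_)
open import Data.Nat.DivMod using (_/_; _%_)
open import Data.Nat.Coprimality using (coprime?)
open import Data.Nat.Logarithm using (⌊log₂_⌋)
open import Data.List using (List; length; filter; map; foldr; upTo)
open import Data.Nat.ListAction using (sum)

-- reduction mod m, i.e. 𝔪_m(x) for x ≥ 0 (m = 0 never occurs in the theorem)
modN : ℕ → ℕ → ℕ
modN zero x = x
modN (suc k) x = x % suc k

-- ⌊y / m⌋ (m = 0 never occurs in the theorem)
divN : ℕ → ℕ → ℕ
divN y zero = 0
divN y (suc k) = y / suc k

-- bin of x under multiplier a:  ⌊ 𝔪_m(a x) / (m/n) ⌋ = ⌊ n · 𝔪_m(a x) / m ⌋
bin : (m n a x : ℕ) → ℕ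
bin m n a x = divN (n * modN m (a * x)) m

load : (m n a : ℕ) → List ℕ → ℕ → ℕ
load m n a X b = length (filter (λ x → bin m n a x ≟ b) X)

maxload : (m n a : ℕ) → List ℕ → ℕ
maxload m n a X = foldr _⊔_ 0 (map (load m n a X) (upTo n))

units : ℕ → List ℕ
units m = filter (λ k → coprime? k m) (upTo m)

-- sum over a ∈ ℤ_m^× of maxload; expected maxload = totalMaxload / |ℤ_m^×|
totalMaxload : (m n : ℕ) → List ℕ → ℕ
totalMaxload m n X = sum (map (λ a → maxload m n a X) (units m))

loglog : ℕ → ℕ
loglog n = ⌊log₂ ⌊log₂ n ⌋ ⌋

-- By Cauchy–Schwarz over the multipliers a ∈ ℤ_m^×, (Σ_a maxload_a)² ≤ φ(m) Σ_a maxload_a², and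
-- maxload_a² is at most the number of pairs (x, y) ∈ X² that a sends to the same bin. For x ≠ y with
-- d = x − y, a collision forces a d or a (m − d) to have residue in (0, m / n); since a ↦ a d mod m
-- takes each multiple of gcd(m, d) equally often, at most 2 m / n multipliers collide x and y. Hence
-- (Σ_a maxload_a)² ≤ φ(m) n (φ(m) + 2 m), and it remains to show m / φ(m) = O(log log n).
--
-- With P the radical of m, m / φ(m) = Π_{p ∣ m} p / (p − 1) ≤ 2 Π_{p ∣ m} (1 + 1 / p) = 2 σ(P) / P.
-- By Rankin's trick, σ(P) / P ≤ 2 (Y + 1) as soon as Σ_{p ∣ P} log p / p ≤ Y / 2: divisors d > 2^Y
-- are outweighed by their bit length. Finally Σ_{p ∣ P} log p / p = O(J) when m ≤ 2^2^J, by a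
-- Chebyshev-type count for p ≤ 2^J and because at most 2^J / J prime factors of m exceed 2^J;
-- and m ≤ n^C gives J = O(log log n). The hypothesis n^6 ≤ m is only used to exclude m = 0.

module Submission where

open import Defs
open import Data.Nat using (ℕ; _*_; _^_; _≤_; _<_)
open import Data.Product using (∃-syntax)
open import Data.List using (List; length)
open import Data.List.Relation.Unary.All using (All)
open import Data.List.Relation.Unary.Unique.Propositional using (Unique)
open import Relation.Binary.PropositionalEquality using (_≡_)

open import Data.Nat
open import Data.Nat.Properties
open import Data.Nat.Divisibility
open import Data.Nat.DivMod
open import Data.Nat.Coprimality using (Coprime; coprime?; coprime-divisor; coprime-/gcd; gcd≡1⇒coprime)
import Data.Nat.Coprimality as Coprime
open import Data.Nat.GCD using (gcd; gcd[m,n]∣m; gcd[m,n]∣n; gcd[m,n]≢0)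
open import Data.Nat.Primality
open import Data.Nat.Primality.Factorisation using (factorise)
open import Data.Nat.Logarithm
open import Data.Nat.Induction using (<-rec)
open import Data.Nat.ListAction using (sum; product)
open import Data.Nat.Tactic.RingSolver using (solve-∀)
open import Data.List using ([]; _∷_; filter; map; upTo; applyUpTo; foldr)
open import Data.List.Properties using (length-map)
open import Data.List.Relation.Unary.All as All using ([]; _∷_)
import Data.List.Relation.Unary.All.Properties as All
open import Data.List.Relation.Unary.AllPairs using ([]; _∷_)
import Data.List.Relation.Unary.Unique.Propositional.Properties as Unique
open import Data.Product using (Σ; _×_; _,_; proj₁; proj₂)
open import Data.Sum using (_⊎_; inj₁; inj₂; [_,_]′)
open import Data.Empty using (⊥-elim)
open import Function using (_∘_; id)
open import Relation.Nullary using (Dec; yes; no; ¬_)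
open import Relation.Nullary.Decidable using (_×-dec_; ¬?)
open import Relation.Unary using (Decidable)
open import Relation.Binary.Definitions using (tri<; tri≈; tri>)
import Algebra.Properties.CommutativeSemigroup as CommutativeSemigroup
open CommutativeSemigroup +-commutativeSemigroup using () renaming (interchange to +-interchange)
open CommutativeSemigroup *-commutativeSemigroup using () renaming (interchange to *-interchange)
open import Relation.Binary.PropositionalEquality using (_≢_; refl; sym; trans; cong; cong₂; subst; subst₂; module ≡-Reasoning)

-- Indicators, finite sums and products

𝟙 : ∀ {a} {A : Set a} → Dec A → ℕ
𝟙 (yes _) = 1
𝟙 (no _) = 0

module _ {a} {A : Set a} where

  𝟙≤1 : (d : Dec A) → 𝟙 d ≤ 1
  𝟙≤1 (yes _) = s≤s z≤n
  𝟙≤1 (no _) = z≤n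

  𝟙-yes : (d : Dec A) → A → 𝟙 d ≡ 1
  𝟙-yes (yes _) _ = refl
  𝟙-yes (no ¬x) x = ⊥-elim (¬x x)

  𝟙-no : (d : Dec A) → ¬ A → 𝟙 d ≡ 0
  𝟙-no (yes x) ¬x = ⊥-elim (¬x x)
  𝟙-no (no _) _ = refl

  𝟙*n≤n : (d : Dec A) → ∀ n → 𝟙 d * n ≤ n
  𝟙*n≤n (yes _) n = ≤-reflexive (*-identityˡ n)
  𝟙*n≤n (no _) n = z≤n

  𝟙-split : (d : Dec A) → ∀ n → 𝟙 d * n + 𝟙 (¬? d) * n ≡ n
  𝟙-split (yes _) n = trans (+-identityʳ (1 * n)) (*-identityˡ n)
  𝟙-split (no _) n = *-identityˡ n

  𝟙-cong : ∀ {b} {B : Set b} (d : Dec A) (e : Dec B) → (A → B) → (B → A) → 𝟙 d ≡ 𝟙 e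
  𝟙-cong (yes _) (yes _) _ _ = refl
  𝟙-cong (yes x) (no ¬y) f _ = ⊥-elim (¬y (f x))
  𝟙-cong (no ¬x) (yes y) _ g = ⊥-elim (¬x (g y))
  𝟙-cong (no _) (no _) _ _ = refl

Σ< : (ℕ → ℕ) → ℕ → ℕ
Σ< f zero = 0
Σ< f (suc n) = Σ< f n + f n

module _ where
  open ≡-Reasoning

  Σ<-cong : ∀ {f g} n → (∀ i → i < n → f i ≡ g i) → Σ< f n ≡ Σ< g n
  Σ<-cong zero h = refl
  Σ<-cong (suc n) h = cong₂ _+_ (Σ<-cong n (λ i i<n → h i (m<n⇒m<1+n i<n))) (h n ≤-refl)

  Σ<-mono-≤ : ∀ {f g} n → (∀ i → i < n → f i ≤ g i) → Σ< f n ≤ Σ< g n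
  Σ<-mono-≤ zero h = z≤n
  Σ<-mono-≤ (suc n) h = +-mono-≤ (Σ<-mono-≤ n (λ i i<n → h i (m<n⇒m<1+n i<n))) (h n ≤-refl)

  Σ<-zero : ∀ {f} n → (∀ i → i < n → f i ≡ 0) → Σ< f n ≡ 0
  Σ<-zero zero h = refl
  Σ<-zero (suc n) h = cong₂ _+_ (Σ<-zero n (λ i i<n → h i (m<n⇒m<1+n i<n))) (h n ≤-refl)

  Σ<-distrib-+ : ∀ f g n → Σ< (λ i → f i + g i) n ≡ Σ< f n + Σ< g n
  Σ<-distrib-+ f g zero = refl
  Σ<-distrib-+ f g (suc n) =
    trans (cong (_+ (f n + g n)) (Σ<-distrib-+ f g n)) (+-interchange (Σ< f n) (Σ< g n) (f n) (g n))

  Σ<-*ˡ : ∀ c f n → Σ< (λ i → c * f i) n ≡ c * Σ< f n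
  Σ<-*ˡ c f zero = sym (*-zeroʳ c)
  Σ<-*ˡ c f (suc n) = trans (cong (_+ c * f n) (Σ<-*ˡ c f n)) (sym (*-distribˡ-+ c (Σ< f n) (f n)))

  Σ<-const : ∀ c n → Σ< (λ _ → c) n ≡ n * c
  Σ<-const c zero = refl
  Σ<-const c (suc n) = trans (cong (_+ c) (Σ<-const c n)) (+-comm (n * c) c)

  Σ<-suc : ∀ f n → Σ< f (suc n) ≡ f 0 + Σ< (f ∘ suc) n
  Σ<-suc f zero = +-comm 0 (f 0)
  Σ<-suc f (suc n) = trans (cong (_+ f (suc n)) (Σ<-suc f n)) (+-assoc (f 0) (Σ< (f ∘ suc) n) (f (suc n)))

  Σ<-+ : ∀ f a b → Σ< f (a + b) ≡ Σ< f a + Σ< (λ i → f (a + i)) b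
  Σ<-+ f a zero = trans (cong (Σ< f) (+-identityʳ a)) (sym (+-identityʳ _))
  Σ<-+ f a (suc b) = begin
    Σ< f (a + suc b)                                    ≡⟨ cong (Σ< f) (+-suc a b) ⟩
    Σ< f (a + b) + f (a + b)                            ≡⟨ cong (_+ f (a + b)) (Σ<-+ f a b) ⟩
    Σ< f a + Σ< (λ i → f (a + i)) b + f (a + b)         ≡⟨ +-assoc (Σ< f a) _ (f (a + b)) ⟩
    Σ< f a + Σ< (λ i → f (a + i)) (suc b)               ∎

  Σ<-monoʳ-≤ : ∀ f {n n′} → n ≤ n′ → Σ< f n ≤ Σ< f n′
  Σ<-monoʳ-≤ f {n} n≤n′ with m≤n⇒∃[o]m+o≡n n≤n′
  ... | k , refl = ≤-trans (m≤m+n (Σ< f n) _) (≤-reflexive (sym (Σ<-+ f n k)))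

  Σ<-vanishing : ∀ f {n n′} → n ≤ n′ → (∀ i → n ≤ i → f i ≡ 0) → Σ< f n′ ≡ Σ< f n
  Σ<-vanishing f {n} n≤n′ h with m≤n⇒∃[o]m+o≡n n≤n′
  ... | k , refl = begin
    Σ< f (n + k)                           ≡⟨ Σ<-+ f n k ⟩
    Σ< f n + Σ< (λ i → f (n + i)) k        ≡⟨ cong (Σ< f n +_) (Σ<-zero k (λ i _ → h (n + i) (m≤m+n n i))) ⟩
    Σ< f n + 0                             ≡⟨ +-identityʳ _ ⟩
    Σ< f n                                 ∎

Σl : ∀ {a} {A : Set a} → (A → ℕ) → List A → ℕ
Σl f [] = 0
Σl f (x ∷ xs) = f x + Σl f xs

module _ {a} {A : Set a} where
  open ≡-Reasoning

  Σl-cong : ∀ {f g : A → ℕ} xs → (∀ x → f x ≡ g x) → Σl f xs ≡ Σl g xs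
  Σl-cong [] h = refl
  Σl-cong (x ∷ xs) h = cong₂ _+_ (h x) (Σl-cong xs h)

  Σl-mono-≤ : ∀ {f g : A → ℕ} xs → (∀ x → f x ≤ g x) → Σl f xs ≤ Σl g xs
  Σl-mono-≤ [] h = z≤n
  Σl-mono-≤ (x ∷ xs) h = +-mono-≤ (h x) (Σl-mono-≤ xs h)

  Σl-All-mono-≤ : ∀ {f g : A → ℕ} {xs} → All (λ x → f x ≤ g x) xs → Σl f xs ≤ Σl g xs
  Σl-All-mono-≤ [] = z≤n
  Σl-All-mono-≤ (h ∷ hs) = +-mono-≤ h (Σl-All-mono-≤ hs)

  Σl-distrib-+ : ∀ (f g : A → ℕ) xs → Σl (λ x → f x + g x) xs ≡ Σl f xs + Σl g xs
  Σl-distrib-+ f g [] = refl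
  Σl-distrib-+ f g (x ∷ xs) =
    trans (cong (f x + g x +_) (Σl-distrib-+ f g xs)) (+-interchange (f x) (g x) (Σl f xs) (Σl g xs))

  Σl-*ˡ : ∀ c (f : A → ℕ) xs → Σl (λ x → c * f x) xs ≡ c * Σl f xs
  Σl-*ˡ c f [] = sym (*-zeroʳ c)
  Σl-*ˡ c f (x ∷ xs) = trans (cong (c * f x +_) (Σl-*ˡ c f xs)) (sym (*-distribˡ-+ c (f x) (Σl f xs)))

  Σl-*ʳ : ∀ (f : A → ℕ) c xs → Σl f xs * c ≡ Σl (λ x → f x * c) xs
  Σl-*ʳ f c xs = begin
    Σl f xs * c             ≡⟨ *-comm (Σl f xs) c ⟩
    c * Σl f xs             ≡⟨ Σl-*ˡ c f xs ⟨
    Σl (λ x → c * f x) xs   ≡⟨ Σl-cong xs (λ x → *-comm c (f x)) ⟩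
    Σl (λ x → f x * c) xs   ∎

  Σl-const : ∀ c (xs : List A) → Σl (λ _ → c) xs ≡ length xs * c
  Σl-const c [] = refl
  Σl-const c (x ∷ xs) = cong (c +_) (Σl-const c xs)

  Σl-Σ<-comm : ∀ (g : A → ℕ → ℕ) xs n → Σl (λ x → Σ< (g x) n) xs ≡ Σ< (λ i → Σl (λ x → g x i) xs) n
  Σl-Σ<-comm g [] n = sym (Σ<-zero n (λ _ _ → refl))
  Σl-Σ<-comm g (x ∷ xs) n = begin
    Σ< (g x) n + Σl (λ x → Σ< (g x) n) xs           ≡⟨ cong (Σ< (g x) n +_) (Σl-Σ<-comm g xs n) ⟩
    Σ< (g x) n + Σ< (λ i → Σl (λ x → g x i) xs) n   ≡⟨ Σ<-distrib-+ (g x) _ n ⟨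
    Σ< (λ i → g x i + Σl (λ x → g x i) xs) n        ∎

  sum-map : ∀ (f : A → ℕ) xs → sum (map f xs) ≡ Σl f xs
  sum-map f [] = refl
  sum-map f (x ∷ xs) = cong (f x +_) (sum-map f xs)

  module _ {p} {P : A → Set p} (P? : Decidable P) where

    length-filter : ∀ xs → length (filter P? xs) ≡ Σl (𝟙 ∘ P?) xs
    length-filter [] = refl
    length-filter (x ∷ xs) with P? x
    ... | yes _ = cong suc (length-filter xs)
    ... | no _ = length-filter xs

    Σl-filter : ∀ (f : A → ℕ) xs → Σl f (filter P? xs) ≡ Σl (λ x → 𝟙 (P? x) * f x) xs
    Σl-filter f [] = refl
    Σl-filter f (x ∷ xs) with P? x
    ... | yes _ = cong₂ _+_ (sym (+-identityʳ (f x))) (Σl-filter f xs)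
    ... | no _ = Σl-filter f xs

Σl-comm : ∀ {a b} {A : Set a} {B : Set b} (g : A → B → ℕ) xs (ys : List B) →
  Σl (λ x → Σl (g x) ys) xs ≡ Σl (λ y → Σl (λ x → g x y) xs) ys
Σl-comm g [] ys = sym (trans (Σl-const 0 ys) (*-zeroʳ (length ys)))
Σl-comm g (x ∷ xs) ys = begin
  Σl (g x) ys + Σl (λ x → Σl (g x) ys) xs           ≡⟨ cong (Σl (g x) ys +_) (Σl-comm g xs ys) ⟩
  Σl (g x) ys + Σl (λ y → Σl (λ x → g x y) xs) ys   ≡⟨ Σl-distrib-+ (g x) _ ys ⟨
  Σl (λ y → g x y + Σl (λ x → g x y) xs) ys         ∎
  where open ≡-Reasoning

Σl-applyUpTo : ∀ (f g : ℕ → ℕ) n → Σl f (applyUpTo g n) ≡ Σ< (f ∘ g) n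
Σl-applyUpTo f g zero = refl
Σl-applyUpTo f g (suc n) = trans (cong (f (g 0) +_) (Σl-applyUpTo f (g ∘ suc) n)) (sym (Σ<-suc (f ∘ g) n))

Σl-upTo : ∀ (f : ℕ → ℕ) n → Σl f (upTo n) ≡ Σ< f n
Σl-upTo f = Σl-applyUpTo f id

Πl : (ℕ → ℕ) → List ℕ → ℕ
Πl f [] = 1
Πl f (x ∷ xs) = f x * Πl f xs

Πl-mono-≤ : ∀ {f g xs} → All (λ x → f x ≤ g x) xs → Πl f xs ≤ Πl g xs
Πl-mono-≤ [] = ≤-refl
Πl-mono-≤ (h ∷ hs) = *-mono-≤ h (Πl-mono-≤ hs)

Πl-distrib-* : ∀ f g xs → Πl (λ x → f x * g x) xs ≡ Πl f xs * Πl g xs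
Πl-distrib-* f g [] = refl
Πl-distrib-* f g (x ∷ xs) =
  trans (cong (f x * g x *_) (Πl-distrib-* f g xs)) (*-interchange (f x) (g x) (Πl f xs) (Πl g xs))

Πl-2^ : ∀ (g : ℕ → ℕ) xs → Πl (λ x → 2 ^ g x) xs ≡ 2 ^ Σl g xs
Πl-2^ g [] = refl
Πl-2^ g (x ∷ xs) = trans (cong (2 ^ g x *_) (Πl-2^ g xs)) (sym (^-distribˡ-+-* 2 (g x) (Σl g xs)))

-- Elementary inequalities and binary logarithms

*-cancelʳ-≤′ : ∀ m n o → 1 ≤ o → m * o ≤ n * o → m ≤ n
*-cancelʳ-≤′ m n (suc o) _ = *-cancelʳ-≤ m n (suc o)

n<2^n : ∀ n → n < 2 ^ n
n<2^n zero = s≤s z≤n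
n<2^n (suc n) = begin-strict
    suc n          <⟨ s≤s (n<2^n n) ⟩
    suc (2 ^ n)    ≤⟨ +-monoˡ-≤ (2 ^ n) (m^n>0 2 n) ⟩
    2 ^ n + 2 ^ n  ≡⟨ cong (2 ^ n +_) (+-identityʳ (2 ^ n)) ⟨
    2 ^ suc n      ∎
  where open ≤-Reasoning

2^m≤n⇒m≤⌊log₂n⌋ : ∀ m n → 2 ^ m ≤ n → m ≤ ⌊log₂ n ⌋
2^m≤n⇒m≤⌊log₂n⌋ m n 2^m≤n = subst (_≤ ⌊log₂ n ⌋) (⌊log₂[2^n]⌋≡n m) (⌊log₂⌋-mono-≤ 2^m≤n)

2^-cancel-≤ : ∀ m n → 2 ^ m ≤ 2 ^ n → m ≤ n
2^-cancel-≤ m n h = subst (m ≤_) (⌊log₂[2^n]⌋≡n n) (2^m≤n⇒m≤⌊log₂n⌋ m (2 ^ n) h)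

n<2^[1+⌊log₂n⌋] : ∀ n → n < 2 ^ suc ⌊log₂ n ⌋
n<2^[1+⌊log₂n⌋] n with n <? 2 ^ suc ⌊log₂ n ⌋
... | yes n< = n<
... | no n≮ = ⊥-elim (<-irrefl refl (2^m≤n⇒m≤⌊log₂n⌋ (suc ⌊log₂ n ⌋) n (≮⇒≥ n≮)))

2^⌊log₂n⌋≤n : ∀ n → 1 ≤ n → 2 ^ ⌊log₂ n ⌋ ≤ n
2^⌊log₂n⌋≤n = <-rec (λ n → 1 ≤ n → 2 ^ ⌊log₂ n ⌋ ≤ n) step
  where
  step : ∀ n → (∀ {k} → k < n → 1 ≤ k → 2 ^ ⌊log₂ k ⌋ ≤ k) → 1 ≤ n → 2 ^ ⌊log₂ n ⌋ ≤ n
  step 1 _ _ = ≤-refl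
  step n@(suc (suc k)) rec _ = begin
      2 ^ ⌊log₂ n ⌋          ≡⟨ cong (2 ^_) log≡ ⟩
      2 * 2 ^ ⌊log₂ h ⌋      ≤⟨ *-monoʳ-≤ 2 (rec (⌊n/2⌋<n (suc k)) (s≤s z≤n)) ⟩
      2 * h                  ≡⟨ cong (h +_) (+-identityʳ h) ⟩
      h + h                  ≤⟨ +-monoʳ-≤ h (⌊n/2⌋≤⌈n/2⌉ n) ⟩
      h + ⌈ n /2⌉            ≡⟨ ⌊n/2⌋+⌈n/2⌉≡n n ⟩
      n                      ∎
    where
    open ≤-Reasoning
    h = ⌊ n /2⌋
    log≡ : ⌊log₂ n ⌋ ≡ suc ⌊log₂ h ⌋
    log≡ = begin-equality
      ⌊log₂ n ⌋              ≡⟨ m∸n+n≡m (2^m≤n⇒m≤⌊log₂n⌋ 1 n (s≤s (s≤s z≤n))) ⟨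
      ⌊log₂ n ⌋ ∸ 1 + 1      ≡⟨ +-comm _ 1 ⟩
      suc (⌊log₂ n ⌋ ∸ 1)    ≡⟨ cong suc (⌊log₂⌊n/2⌋⌋≡⌊log₂n⌋∸1 n) ⟨
      suc ⌊log₂ h ⌋          ∎

2*m*n≤m*m+n*n : ∀ m n → 2 * m * n ≤ m * m + n * n
2*m*n≤m*m+n*n m n with ≤-total m n
... | inj₁ m≤n with m≤n⇒∃[o]m+o≡n m≤n
...   | d , refl = subst (2 * m * (m + d) ≤_) (sym (square m d)) (m≤m+n _ (d * d))
  where
  square : ∀ m d → m * m + (m + d) * (m + d) ≡ 2 * m * (m + d) + d * d
  square = solve-∀
2*m*n≤m*m+n*n m n | inj₂ n≤m with m≤n⇒∃[o]m+o≡n n≤m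
...   | d , refl = subst (2 * (n + d) * n ≤_) (sym (square n d)) (m≤m+n _ (d * d))
  where
  square : ∀ n d → (n + d) * (n + d) + n * n ≡ 2 * (n + d) * n + d * d
  square = solve-∀

module _ {a} {A : Set a} where

  private
    crossTerm : ∀ v s k Q → s * s ≤ k * Q → 2 * v * s ≤ Q + k * (v * v)
    crossTerm v zero k Q _ = ≤-trans (≤-reflexive (*-zeroʳ (2 * v))) z≤n
    crossTerm v (suc s′) (suc k′) Q s²≤kQ = *-cancelʳ-≤′ _ _ k (s≤s z≤n) (begin
        2 * v * s * k                ≡⟨ reorder v s k ⟩
        2 * (k * v) * s              ≤⟨ 2*m*n≤m*m+n*n (k * v) s ⟩
        k * v * (k * v) + s * s      ≤⟨ +-monoʳ-≤ (k * v * (k * v)) s²≤kQ ⟩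
        k * v * (k * v) + k * Q      ≡⟨ factor v k Q ⟩
        (Q + k * (v * v)) * k        ∎)
      where
      open ≤-Reasoning
      s = suc s′
      k = suc k′
      reorder : ∀ v s k → 2 * v * s * k ≡ 2 * (k * v) * s
      reorder = solve-∀
      factor : ∀ v k Q → k * v * (k * v) + k * Q ≡ (Q + k * (v * v)) * k
      factor = solve-∀

  cauchy-schwarz : ∀ (f : A → ℕ) xs → Σl f xs * Σl f xs ≤ length xs * Σl (λ x → f x * f x) xs
  cauchy-schwarz f [] = z≤n
  cauchy-schwarz f (x ∷ xs) = begin
      (v + s) * (v + s)                         ≡⟨ expand v s ⟩
      v * v + (2 * v * s + s * s)               ≤⟨ +-monoʳ-≤ (v * v) (+-mono-≤ (crossTerm v s k Q IH) IH) ⟩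
      v * v + (Q + k * (v * v) + k * Q)         ≡⟨ collect v Q k ⟩
      suc k * (v * v + Q)                       ∎
    where
    open ≤-Reasoning
    v = f x
    s = Σl f xs
    k = length xs
    Q = Σl (λ x → f x * f x) xs
    IH = cauchy-schwarz f xs
    expand : ∀ v s → (v + s) * (v + s) ≡ v * v + (2 * v * s + s * s)
    expand = solve-∀
    collect : ∀ v Q k → v * v + (Q + k * (v * v) + k * Q) ≡ (1 + k) * (v * v + Q)
    collect = solve-∀

-- Descending lists of primes and their radicals

prime⇒≥2 : ∀ {p} → Prime p → 2 ≤ p
prime⇒≥2 {p} pp = nonTrivial⇒n>1 p {{prime⇒nonTrivial pp}}

prime⇒≥1 : ∀ {p} → Prime p → 1 ≤ p
prime⇒≥1 pp = ≤-trans (s≤s z≤n) (prime⇒≥2 pp)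

prime∣prime⇒≡ : ∀ {p q} → Prime p → Prime q → p ∣ q → p ≡ q
prime∣prime⇒≡ pp pq p∣q with prime⇒irreducible pq p∣q
... | inj₁ refl = ⊥-elim (¬prime[1] pp)
... | inj₂ p≡q = p≡q

prime∤1 : ∀ {p} → Prime p → ¬ p ∣ 1
prime∤1 pp p∣1 with ∣1⇒≡1 p∣1
... | refl = ¬prime[1] pp

prime∤⇒coprime : ∀ {p n} → Prime p → ¬ p ∣ n → Coprime n p
prime∤⇒coprime pp p∤n (i∣n , i∣p) with prime⇒irreducible pp i∣p
... | inj₁ i≡1 = i≡1
... | inj₂ refl = ⊥-elim (p∤n i∣n)

∣⇒≤′ : ∀ {m n} → 1 ≤ n → m ∣ n → m ≤ n
∣⇒≤′ {n = suc _} _ = ∣⇒≤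

data DescendingPrimes : List ℕ → Set where
  [] : DescendingPrimes []
  cons : ∀ {p S} → Prime p → All (_< p) S → DescendingPrimes S → DescendingPrimes (p ∷ S)

descending⇒primes : ∀ {S} → DescendingPrimes S → All Prime S
descending⇒primes [] = []
descending⇒primes (cons pp _ ds) = pp ∷ descending⇒primes ds

Πl-id≥1 : ∀ {S} → All Prime S → 1 ≤ Πl id S
Πl-id≥1 [] = ≤-refl
Πl-id≥1 (pp ∷ ps) = *-mono-≤ (prime⇒≥1 pp) (Πl-id≥1 ps)

∈⇒∣Πl-id : ∀ S → All (_∣ Πl id S) S
∈⇒∣Πl-id [] = []
∈⇒∣Πl-id (p ∷ S) = m∣m*n (Πl id S) ∷ All.map (∣n⇒∣m*n p) (∈⇒∣Πl-id S)

radFactor : ℕ → ℕ → ℕ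
radFactor n p = p ^ 𝟙 (p ∣? n)

radFactor≡p⊎1 : ∀ n p → radFactor n p ≡ p ⊎ radFactor n p ≡ 1
radFactor≡p⊎1 n p with p ∣? n
... | yes _ = inj₁ (*-identityʳ p)
... | no _ = inj₂ refl

radFactor-∣ : ∀ {n p} → p ∣ n → radFactor n p ≡ p
radFactor-∣ {n} {p} p∣n with p ∣? n
... | yes _ = *-identityʳ p
... | no p∤n = ⊥-elim (p∤n p∣n)

radFactor-mono : ∀ {m n} p → 1 ≤ p → (p ∣ m → p ∣ n) → radFactor m p ≤ radFactor n p
radFactor-mono {m} {n} p p≥1 m⇒n with p ∣? m | p ∣? n
... | yes _ | yes _ = ≤-refl
... | yes p∣m | no p∤n = ⊥-elim (p∤n (m⇒n p∣m))
... | no _ | yes _ = subst (1 ≤_) (sym (*-identityʳ p)) p≥1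
... | no _ | no _ = ≤-refl

prime∤Πl : ∀ {q} f {S} → Prime q → All Prime S → All (_< q) S →
  (∀ p → f p ≡ p ⊎ f p ≡ 1) → ¬ q ∣ Πl f S
prime∤Πl f pq [] [] _ q∣1 = prime∤1 pq q∣1
prime∤Πl {q} f {p ∷ S} pq (pp ∷ ps) (p<q ∷ ls) f≡ q∣ with euclidsLemma (f p) (Πl f S) pq q∣
... | inj₂ q∣rest = prime∤Πl f pq ps ls f≡ q∣rest
... | inj₁ q∣fp with f≡ p
...   | inj₂ fp≡1 = prime∤1 pq (subst (q ∣_) fp≡1 q∣fp)
...   | inj₁ fp≡p = <⇒≱ p<q (∣⇒≤′ (prime⇒≥1 pp) (subst (q ∣_) fp≡p q∣fp))

prime∤Πl-id : ∀ {q S} → Prime q → DescendingPrimes S → All (_< q) S → ¬ q ∣ Πl id S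
prime∤Πl-id pq ds ls = prime∤Πl id pq (descending⇒primes ds) ls (λ _ → inj₁ refl)

Πl-radFactor∣ : ∀ n {S} → DescendingPrimes S → Πl (radFactor n) S ∣ n
Πl-radFactor∣ n [] = 1∣ n
Πl-radFactor∣ n {q ∷ S} (cons pq ls ds) with q ∣? n
... | no _ = subst (_∣ n) (sym (*-identityˡ R)) (Πl-radFactor∣ n ds)
  where R = Πl (radFactor n) S
... | yes q∣n = subst (_∣ n) (cong (_* R) (sym (*-identityʳ q))) (q*R∣n (Πl-radFactor∣ n ds))
  where
  R = Πl (radFactor n) S
  q∤R : ¬ q ∣ R
  q∤R = prime∤Πl (radFactor n) pq (descending⇒primes ds) ls (radFactor≡p⊎1 n)
  q*R∣n : R ∣ n → q * R ∣ n
  q*R∣n (divides r n≡rR) with coprime-divisor (Coprime.sym (prime∤⇒coprime pq q∤R))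
                                (subst (q ∣_) (trans n≡rR (*-comm r R)) q∣n)
  ... | divides s r≡sq = divides s (begin
    n          ≡⟨ n≡rR ⟩
    r * R      ≡⟨ cong (_* R) r≡sq ⟩
    s * q * R  ≡⟨ *-assoc s q R ⟩
    s * (q * R) ∎)
    where open ≡-Reasoning

∣Πl-id⇒≤Πl-radFactor : ∀ {S} d → DescendingPrimes S → d ∣ Πl id S → d ≤ Πl (radFactor d) S
∣Πl-id⇒≤Πl-radFactor d [] d∣1 = ≤-reflexive (∣1⇒≡1 d∣1)
∣Πl-id⇒≤Πl-radFactor {q ∷ S} d (cons pq ls ds) d∣qP with q ∣? d
... | no q∤d = subst (d ≤_) (sym (*-identityˡ _))
                 (∣Πl-id⇒≤Πl-radFactor d ds (coprime-divisor (prime∤⇒coprime pq q∤d) d∣qP))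
... | yes (divides e refl) = begin
      e * q                            ≡⟨ *-comm e q ⟩
      q * e                            ≤⟨ *-monoʳ-≤ q (∣Πl-id⇒≤Πl-radFactor e ds e∣P) ⟩
      q * Πl (radFactor e) S           ≤⟨ *-monoʳ-≤ q (Πl-mono-≤ (All.map (λ pp → radFactor-mono _ (prime⇒≥1 pp) (∣m⇒∣m*n q)) (descending⇒primes ds))) ⟩
      q * Πl (radFactor (e * q)) S     ≡⟨ cong (_* Πl (radFactor (e * q)) S) (*-identityʳ q) ⟨
      q * 1 * Πl (radFactor (e * q)) S ∎
  where
  open ≤-Reasoning
  e∣P : e ∣ Πl id S
  e∣P = *-cancelʳ-∣ q {{prime⇒nonZero pq}} (subst (e * q ∣_) (*-comm q (Πl id S)) d∣qP)

-- Legendre's sieve and Euler's totient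

∤q*Q+r : ∀ q Q r → 0 < r → r < q → ¬ q ∣ q * Q + r
∤q*Q+r q Q r 0<r r<q q∣ = <⇒≱ r<q (∣⇒≤′ 0<r (∣m+n∣m⇒∣n q∣ (m∣m*n Q)))

Σ<-multiples : ∀ q → 1 ≤ q → (f : ℕ → ℕ) → ∀ Q →
  Σ< (λ t → 𝟙 (q ∣? t) * f t) (q * Q) ≡ Σ< (λ s → f (q * s)) Q
Σ<-multiples q q≥1 f zero = cong (Σ< _) (*-zeroʳ q)
Σ<-multiples (suc q′) q≥1 f (suc Q) = begin
    Σ< g (q * suc Q)                            ≡⟨ cong (Σ< g) (trans (*-suc q Q) (+-comm q (q * Q))) ⟩
    Σ< g (q * Q + q)                            ≡⟨ Σ<-+ g (q * Q) q ⟩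
    Σ< g (q * Q) + Σ< (λ i → g (q * Q + i)) q   ≡⟨ cong₂ _+_ (Σ<-multiples q q≥1 f Q) oneMultiple ⟩
    Σ< (λ s → f (q * s)) Q + f (q * Q)          ∎
  where
  open ≡-Reasoning
  q = suc q′
  g = λ t → 𝟙 (q ∣? t) * f t
  oneMultiple : Σ< (λ i → g (q * Q + i)) q ≡ f (q * Q)
  oneMultiple = begin
    Σ< (λ i → g (q * Q + i)) q                  ≡⟨ Σ<-suc (λ i → g (q * Q + i)) q′ ⟩
    g (q * Q + 0) + Σ< (λ i → g (q * Q + suc i)) q′
      ≡⟨ cong₂ _+_ (cong g (+-identityʳ (q * Q)))
                   (Σ<-zero q′ (λ i i<q′ → cong (_* f (q * Q + suc i)) (𝟙-no (q ∣? (q * Q + suc i)) (∤q*Q+r q Q (suc i) (s≤s z≤n) (s≤s i<q′))))) ⟩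
    g (q * Q) + 0                               ≡⟨ +-identityʳ _ ⟩
    𝟙 (q ∣? q * Q) * f (q * Q)                  ≡⟨ cong (_* f (q * Q)) (𝟙-yes (q ∣? q * Q) (m∣m*n Q)) ⟩
    1 * f (q * Q)                               ≡⟨ *-identityˡ _ ⟩
    f (q * Q)                                   ∎

#multiples : ℕ → ℕ → ℕ
#multiples p x = Σ< (λ i → 𝟙 (p ∣? suc i)) x

#multiples≡ : ∀ q → 1 ≤ q → ∀ Q → #multiples q (q * Q) ≡ Q
#multiples≡ q q≥1 Q = +-cancelˡ-≡ 1 _ _ (begin
    1 + Σ< (λ i → 𝟙 (q ∣? suc i)) (q * Q)                ≡⟨ cong (_+ Σ< (h ∘ suc) (q * Q)) (𝟙-yes (q ∣? 0) (q ∣0)) ⟨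
    h 0 + Σ< (h ∘ suc) (q * Q)                           ≡⟨ Σ<-suc h (q * Q) ⟨
    Σ< h (q * Q) + h (q * Q)                             ≡⟨ cong₂ _+_ multiples (𝟙-yes (q ∣? q * Q) (m∣m*n Q)) ⟩
    Q + 1                                                ≡⟨ +-comm Q 1 ⟩
    1 + Q                                                ∎)
  where
  open ≡-Reasoning
  h = λ t → 𝟙 (q ∣? t)
  multiples : Σ< h (q * Q) ≡ Q
  multiples = begin
    Σ< h (q * Q)                                         ≡⟨ Σ<-cong (q * Q) (λ t _ → *-identityʳ (h t)) ⟨
    Σ< (λ t → 𝟙 (q ∣? t) * 1) (q * Q)                    ≡⟨ Σ<-multiples q q≥1 (λ _ → 1) Q ⟩
    Σ< (λ _ → 1) Q                                       ≡⟨ Σ<-const 1 Q ⟩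
    Q * 1                                                ≡⟨ *-identityʳ Q ⟩
    Q                                                    ∎

avoids : List ℕ → ℕ → ℕ
avoids S t = Πl (λ p → 𝟙 (¬? (p ∣? t))) S

avoids≤1 : ∀ S t → avoids S t ≤ 1
avoids≤1 [] t = ≤-refl
avoids≤1 (p ∷ S) t = *-mono-≤ (𝟙≤1 (¬? (p ∣? t))) (avoids≤1 S t)

avoids-*ˡ : ∀ {q} S t → Prime q → All Prime S → All (_< q) S → avoids S (q * t) ≡ avoids S t
avoids-*ˡ S t pq [] [] = refl
avoids-*ˡ {q} (p ∷ S) t pq (pp ∷ ps) (p<q ∷ ls) = cong₂ _*_ p∤qt⇔p∤t (avoids-*ˡ S t pq ps ls)
  where
  p∣qt⇒p∣t : p ∣ q * t → p ∣ t
  p∣qt⇒p∣t p∣qt with euclidsLemma q t pp p∣qt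
  ... | inj₂ p∣t = p∣t
  ... | inj₁ p∣q = ⊥-elim (<⇒≢ p<q (prime∣prime⇒≡ pp pq p∣q))
  p∤qt⇔p∤t : 𝟙 (¬? (p ∣? q * t)) ≡ 𝟙 (¬? (p ∣? t))
  p∤qt⇔p∤t = 𝟙-cong (¬? (p ∣? q * t)) (¬? (p ∣? t))
    (λ p∤qt p∣t → p∤qt (∣n⇒∣m*n q p∣t)) (λ p∤t p∣qt → p∤t (p∣qt⇒p∣t p∣qt))

primeDivisorsBelow : ℕ → ℕ → List ℕ
primeDivisorsBelow m zero = []
primeDivisorsBelow m (suc k) with prime? k ×-dec k ∣? m
... | yes _ = k ∷ primeDivisorsBelow m k
... | no _ = primeDivisorsBelow m k

module _ (m : ℕ) where

  primeDivisorsBelow-descending : ∀ k → DescendingPrimes (primeDivisorsBelow m k) × All (_< k) (primeDivisorsBelow m k)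
  primeDivisorsBelow-descending zero = [] , []
  primeDivisorsBelow-descending (suc k) with prime? k ×-dec k ∣? m | primeDivisorsBelow-descending k
  ... | yes (pk , _) | ds , l = cons pk l ds , ≤-refl ∷ All.map m<n⇒m<1+n l
  ... | no _ | ds , l = ds , All.map m<n⇒m<1+n l

  primeDivisorsBelow-∣ : ∀ k → All (_∣ m) (primeDivisorsBelow m k)
  primeDivisorsBelow-∣ zero = []
  primeDivisorsBelow-∣ (suc k) with prime? k ×-dec k ∣? m
  ... | yes (_ , k∣m) = k∣m ∷ primeDivisorsBelow-∣ k
  ... | no _ = primeDivisorsBelow-∣ k

  avoids-primeDivisorsBelow : ∀ k {p t} → Prime p → p ∣ m → p < k → p ∣ t → avoids (primeDivisorsBelow m k) t ≡ 0
  avoids-primeDivisorsBelow (suc k) {p} {t} pp p∣m p<k p∣t with prime? k ×-dec k ∣? m | m<1+n⇒m<n∨m≡n p<k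
  ... | yes _ | inj₁ p<k′ = trans (cong (𝟙 (¬? (k ∣? t)) *_) (avoids-primeDivisorsBelow k pp p∣m p<k′ p∣t)) (*-zeroʳ (𝟙 (¬? (k ∣? t))))
  ... | yes _ | inj₂ refl = cong (_* avoids (primeDivisorsBelow m p) t) (𝟙-no (¬? (p ∣? t)) (λ p∤t → p∤t p∣t))
  ... | no _ | inj₁ p<k′ = avoids-primeDivisorsBelow k pp p∣m p<k′ p∣t
  ... | no ¬p∣m | inj₂ refl = ⊥-elim (¬p∣m (pp , p∣m))

primeDivisors : ℕ → List ℕ
primeDivisors m = primeDivisorsBelow m (suc m)

primeDivisors-descending : ∀ m → DescendingPrimes (primeDivisors m)
primeDivisors-descending m = proj₁ (primeDivisorsBelow-descending m (suc m))

primeDivisors-≤ : ∀ m → All (_≤ m) (primeDivisors m)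
primeDivisors-≤ m = All.map (λ { (s≤s p≤m) → p≤m }) (proj₂ (primeDivisorsBelow-descending m (suc m)))

Πl-radFactor≡Πl-id : ∀ n {S} → All (_∣ n) S → Πl (radFactor n) S ≡ Πl id S
Πl-radFactor≡Πl-id n [] = refl
Πl-radFactor≡Πl-id n (p∣n ∷ ps) = cong₂ _*_ (radFactor-∣ p∣n) (Πl-radFactor≡Πl-id n ps)

rad∣ : ∀ m → Πl id (primeDivisors m) ∣ m
rad∣ m = subst (_∣ m) (Πl-radFactor≡Πl-id m (primeDivisorsBelow-∣ m (suc m)))
               (Πl-radFactor∣ m (primeDivisors-descending m))

private
  sieveStep : ∀ X Y P Πp r q′ → (X + Y) * P ≡ r * suc q′ * P * Πp → Y * P ≡ r * P * Πp →
    X * (suc q′ * P) ≡ r * (suc q′ * P) * (q′ * Πp)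
  sieveStep X Y P Πp r q′ h₁ h₂ = begin
      X * (suc q′ * P)             ≡⟨ *-comm X (suc q′ * P) ⟩
      suc q′ * P * X               ≡⟨ *-assoc (suc q′) P X ⟩
      suc q′ * (P * X)             ≡⟨ cong (suc q′ *_) (trans (*-comm P X) XP) ⟩
      suc q′ * (r * q′ * P * Πp)   ≡⟨ regroup r q′ P Πp ⟩
      r * (suc q′ * P) * (q′ * Πp) ∎
    where
    open ≡-Reasoning
    regroup : ∀ r q′ P Πp → suc q′ * (r * q′ * P * Πp) ≡ r * (suc q′ * P) * (q′ * Πp)
    regroup = solve-∀
    split : ∀ r q′ P Πp → r * suc q′ * P * Πp ≡ r * q′ * P * Πp + r * P * Πp
    split = solve-∀
    XP : X * P ≡ r * q′ * P * Πp
    XP = +-cancelʳ-≡ (r * P * Πp) _ _ (begin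
      X * P + r * P * Πp           ≡⟨ cong (X * P +_) h₂ ⟨
      X * P + Y * P                ≡⟨ *-distribʳ-+ P X Y ⟨
      (X + Y) * P                  ≡⟨ h₁ ⟩
      r * suc q′ * P * Πp          ≡⟨ split r q′ P Πp ⟩
      r * q′ * P * Πp + r * P * Πp ∎)

legendre : ∀ {S} → DescendingPrimes S → ∀ r → Σ< (avoids S) (r * Πl id S) * Πl id S ≡ r * Πl id S * Πl pred S
legendre [] r = cong (_* 1) (trans (Σ<-const 1 (r * 1)) (*-identityʳ (r * 1)))
legendre {zero ∷ S} (cons p0 _ _) r = ⊥-elim (¬prime[0] p0)
legendre {q@(suc q′) ∷ S} (cons pq ls ds) r =
  sieveStep (Σ< (avoids (q ∷ S)) (r * (q * P))) (Σ< a (r * P)) P (Πl pred S) r q′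
    (trans (cong (_* P) complement) (trans (cong (λ M → Σ< a M * P) M≡) (legendre ds (r * q))))
    (legendre ds r)
  where
  P = Πl id S
  a = avoids S
  M≡ : r * (q * P) ≡ r * q * P
  M≡ = sym (*-assoc r q P)
  multiplesOfq : Σ< (λ t → 𝟙 (q ∣? t) * a t) (r * (q * P)) ≡ Σ< a (r * P)
  multiplesOfq = begin
    Σ< (λ t → 𝟙 (q ∣? t) * a t) (r * (q * P))  ≡⟨ cong (Σ< _) (trans M≡ (trans (cong (_* P) (*-comm r q)) (*-assoc q r P))) ⟩
    Σ< (λ t → 𝟙 (q ∣? t) * a t) (q * (r * P))  ≡⟨ Σ<-multiples q (prime⇒≥1 pq) a (r * P) ⟩
    Σ< (λ s → a (q * s)) (r * P)               ≡⟨ Σ<-cong (r * P) (λ s _ → avoids-*ˡ S s pq (descending⇒primes ds) ls) ⟩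
    Σ< a (r * P)                               ∎
    where open ≡-Reasoning
  complement : Σ< (avoids (q ∷ S)) (r * (q * P)) + Σ< a (r * P) ≡ Σ< a (r * (q * P))
  complement = begin
    Σ< (avoids (q ∷ S)) (r * (q * P)) + Σ< a (r * P)
      ≡⟨ cong (Σ< (avoids (q ∷ S)) (r * (q * P)) +_) multiplesOfq ⟨
    Σ< (avoids (q ∷ S)) (r * (q * P)) + Σ< (λ t → 𝟙 (q ∣? t) * a t) (r * (q * P))
      ≡⟨ Σ<-distrib-+ (avoids (q ∷ S)) (λ t → 𝟙 (q ∣? t) * a t) (r * (q * P)) ⟨
    Σ< (λ t → 𝟙 (¬? (q ∣? t)) * a t + 𝟙 (q ∣? t) * a t) (r * (q * P))
      ≡⟨ Σ<-cong (r * (q * P)) (λ t _ → trans (+-comm (𝟙 (¬? (q ∣? t)) * a t) _) (𝟙-split (q ∣? t) (a t))) ⟩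
    Σ< a (r * (q * P)) ∎
    where open ≡-Reasoning

primeFactor : ∀ n → 2 ≤ n → Σ ℕ (λ p → Prime p × p ∣ n)
primeFactor (suc n′) 2≤n with factorise (suc n′)
... | record { factors = [] ; isFactorisation = n≡1 } = ⊥-elim (<⇒≢ 2≤n (sym n≡1))
... | record { factors = p ∷ ps ; isFactorisation = n≡ ; factorsPrime = pp ∷ _ } =
  p , pp , divides (product ps) (trans n≡ (*-comm p (product ps)))

avoids≤coprime : ∀ m → 1 ≤ m → ∀ t → avoids (primeDivisors m) t ≤ 𝟙 (coprime? t m)
avoids≤coprime m m≥1 t with coprime? t m
... | yes _ = avoids≤1 (primeDivisors m) t
... | no ¬coprime = ≤-reflexive (avoids-primeDivisorsBelow m (suc m) pp p∣m (s≤s (∣⇒≤′ m≥1 p∣m)) p∣t)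
  where
  g = gcd t m
  2≤g : 2 ≤ g
  2≤g with g in g≡
  ... | zero = ⊥-elim (<⇒≢ m≥1 (sym (0∣⇒≡0 (subst (_∣ m) g≡ (gcd[m,n]∣n t m)))))
  ... | suc zero = ⊥-elim (¬coprime (gcd≡1⇒coprime g≡))
  ... | suc (suc _) = s≤s (s≤s z≤n)
  factor = primeFactor g 2≤g
  p = proj₁ factor
  pp = proj₁ (proj₂ factor)
  p∣t = ∣-trans (proj₂ (proj₂ factor)) (gcd[m,n]∣m t m)
  p∣m = ∣-trans (proj₂ (proj₂ factor)) (gcd[m,n]∣n t m)

φ : ℕ → ℕ
φ m = length (units m)

φ≡Σ<coprime : ∀ m → φ m ≡ Σ< (λ k → 𝟙 (coprime? k m)) m
φ≡Σ<coprime m = trans (length-filter (λ k → coprime? k m) (upTo m)) (Σl-upTo _ m)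

m*Πpred≤φ*rad : ∀ m → 1 ≤ m → m * Πl pred (primeDivisors m) ≤ φ m * Πl id (primeDivisors m)
m*Πpred≤φ*rad m m≥1 with rad∣ m
... | divides r m≡rP = begin
    m * Πl pred S                              ≡⟨ cong (_* Πl pred S) m≡rP ⟩
    r * P * Πl pred S                          ≡⟨ legendre (primeDivisors-descending m) r ⟨
    Σ< (avoids S) (r * P) * P                  ≡⟨ cong (λ M → Σ< (avoids S) M * P) m≡rP ⟨
    Σ< (avoids S) m * P                        ≤⟨ *-monoˡ-≤ P (Σ<-mono-≤ m (λ t _ → avoids≤coprime m m≥1 t)) ⟩
    Σ< (λ k → 𝟙 (coprime? k m)) m * P          ≡⟨ cong (_* P) (φ≡Σ<coprime m) ⟨
    φ m * P                                    ∎
  where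
  open ≤-Reasoning
  S = primeDivisors m
  P = Πl id S

-- Divisor sums and Rankin's trick

divN-exact : ∀ {n d} → d ∣ n → divN n d * d ≡ n
divN-exact {d = zero} d∣n = sym (0∣⇒≡0 d∣n)
divN-exact {d = suc _} d∣n = m/n*n≡m d∣n

*-divN≤ : ∀ n d → d * divN n d ≤ n
*-divN≤ n zero = z≤n
*-divN≤ n (suc d) = subst (_≤ n) (*-comm (n / suc d) (suc d)) (m/n*n≤m n (suc d))

divN-antimono : ∀ n {d e} → 1 ≤ d → d ≤ e → divN n e ≤ divN n d
divN-antimono n {suc d} {suc e} _ d≤e = /-monoʳ-≤ n d≤e

divN-cancelˡ : ∀ p n d → 1 ≤ p → divN (p * n) (p * d) ≡ divN n d
divN-cancelˡ p n zero _ = cong (divN (p * n)) (*-zeroʳ p)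
divN-cancelˡ (suc p) n (suc d) _ = m*n/m*o≡n/o (suc p) n (suc d)

divN-*ˡ : ∀ q {n d} → d ∣ n → divN (q * n) d ≡ q * divN n d
divN-*ˡ q {d = zero} _ = sym (*-zeroʳ q)
divN-*ˡ q {d = suc d} d∣n = *-/-assoc q d∣n

coDiv : ℕ → ℕ → ℕ
coDiv n d = 𝟙 (d ∣? n) * divN n d

-- The sum of divisors as Σ_{d ∣ n} n / d; the term d = 0 vanishes since divN n 0 = 0.
σ : ℕ → ℕ
σ n = Σ< (coDiv n) (suc n)

coDiv≤divN : ∀ n d → coDiv n d ≤ divN n d
coDiv≤divN n d = 𝟙*n≤n (d ∣? n) (divN n d)

coDiv-vanishes : ∀ n {d} → 1 ≤ n → n < d → coDiv n d ≡ 0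
coDiv-vanishes n {d} n≥1 n<d with d ∣? n
... | no _ = refl
... | yes d∣n = ⊥-elim (<⇒≱ n<d (∣⇒≤′ n≥1 d∣n))

σ-multiples : ∀ p n → 1 ≤ p → 1 ≤ n →
  Σ< (λ d → 𝟙 (p ∣? d) * coDiv (p * n) d) (suc (p * n)) ≡ σ n
σ-multiples p n p≥1 n≥1 = begin
    Σ< g (suc (p * n))                         ≡⟨ Σ<-vanishing g suc[pn]≤p*suc[n] beyond ⟨
    Σ< g (p * suc n)                           ≡⟨ Σ<-multiples p p≥1 (coDiv (p * n)) (suc n) ⟩
    Σ< (λ d → coDiv (p * n) (p * d)) (suc n)   ≡⟨ Σ<-cong (suc n) (λ d _ → coDiv-cancelˡ d) ⟩
    σ n                                        ∎
  where
  open ≡-Reasoning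
  g = λ d → 𝟙 (p ∣? d) * coDiv (p * n) d
  suc[pn]≤p*suc[n] : suc (p * n) ≤ p * suc n
  suc[pn]≤p*suc[n] = subst (suc (p * n) ≤_) (sym (*-suc p n)) (+-monoˡ-≤ (p * n) p≥1)
  beyond : ∀ d → suc (p * n) ≤ d → g d ≡ 0
  beyond d pn<d = trans (cong (𝟙 (p ∣? d) *_) (coDiv-vanishes (p * n) (*-mono-≤ p≥1 n≥1) pn<d)) (*-zeroʳ (𝟙 (p ∣? d)))
  coDiv-cancelˡ : ∀ d → coDiv (p * n) (p * d) ≡ coDiv n d
  coDiv-cancelˡ d = cong₂ _*_
    (𝟙-cong (p * d ∣? p * n) (d ∣? n) (*-cancelˡ-∣ p {{>-nonZero p≥1}}) (*-monoʳ-∣ p))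
    (divN-cancelˡ p n d p≥1)

*-σ≤ : ∀ q n → 1 ≤ q → (w : ℕ → ℕ) → (∀ d → d ∣ n → 1 ≤ w d) →
  q * σ n ≤ Σ< (λ d → w d * coDiv (q * n) d) (suc (q * n))
*-σ≤ q n q≥1 w w≥1 = begin
    q * σ n                                          ≡⟨ Σ<-*ˡ q (coDiv n) (suc n) ⟨
    Σ< (λ d → q * coDiv n d) (suc n)                 ≤⟨ Σ<-mono-≤ (suc n) (λ d _ → termwise d) ⟩
    Σ< (λ d → w d * coDiv (q * n) d) (suc n)         ≤⟨ Σ<-monoʳ-≤ _ (s≤s (m≤n*m n q {{>-nonZero q≥1}})) ⟩
    Σ< (λ d → w d * coDiv (q * n) d) (suc (q * n))   ∎
  where
  open ≤-Reasoning
  termwise : ∀ d → q * coDiv n d ≤ w d * coDiv (q * n) d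
  termwise d with d ∣? n | d ∣? q * n
  ... | no _ | _ = ≤-trans (≤-reflexive (*-zeroʳ q)) z≤n
  ... | yes d∣n | no d∤qn = ⊥-elim (d∤qn (∣n⇒∣m*n q d∣n))
  ... | yes d∣n | yes _ = begin
      q * (1 * divN n d)            ≡⟨ cong (q *_) (*-identityˡ (divN n d)) ⟩
      q * divN n d                  ≡⟨ divN-*ˡ q d∣n ⟨
      divN (q * n) d                ≡⟨ *-identityˡ _ ⟨
      1 * divN (q * n) d            ≤⟨ *-monoˡ-≤ (divN (q * n) d) (w≥1 d d∣n) ⟩
      w d * divN (q * n) d          ≡⟨ cong (w d *_) (*-identityˡ _) ⟨
      w d * (1 * divN (q * n) d)    ∎

Πl-suc≤σ : ∀ {S} → DescendingPrimes S → Πl suc S ≤ σ (Πl id S)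
Πl-suc≤σ [] = ≤-refl
Πl-suc≤σ {q ∷ S} (cons pq ls ds) = begin
    suc q * Πl suc S                     ≤⟨ *-monoʳ-≤ (suc q) (Πl-suc≤σ ds) ⟩
    σ P′ + q * σ P′                      ≤⟨ +-mono-≤ (≤-reflexive (sym (σ-multiples q P′ q≥1 P′≥1))) nonMultiples ⟩
    Σ< (λ d → 𝟙 (q ∣? d) * coDiv P d) (suc P) + Σ< (λ d → 𝟙 (¬? (q ∣? d)) * coDiv P d) (suc P)
                                         ≡⟨ Σ<-distrib-+ _ _ (suc P) ⟨
    Σ< (λ d → 𝟙 (q ∣? d) * coDiv P d + 𝟙 (¬? (q ∣? d)) * coDiv P d) (suc P)
                                         ≡⟨ Σ<-cong (suc P) (λ d _ → 𝟙-split (q ∣? d) (coDiv P d)) ⟩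
    σ P                                  ∎
  where
  open ≤-Reasoning
  P′ = Πl id S
  P = q * P′
  q≥1 = prime⇒≥1 pq
  P′≥1 = Πl-id≥1 (descending⇒primes ds)
  nonMultiples : q * σ P′ ≤ Σ< (λ d → 𝟙 (¬? (q ∣? d)) * coDiv P d) (suc P)
  nonMultiples = *-σ≤ q P′ q≥1 (λ d → 𝟙 (¬? (q ∣? d)))
    (λ d d∣P′ → ≤-reflexive (sym (𝟙-yes (¬? (q ∣? d)) (λ q∣d → prime∤Πl-id pq ds ls (∣-trans q∣d d∣P′)))))

Σ<divN≤ : ∀ n Y → Σ< (divN n) (2 ^ Y) ≤ n * Y
Σ<divN≤ n zero = z≤n
Σ<divN≤ n (suc Y) = begin
    Σ< (divN n) (2 ^ Y + (2 ^ Y + 0))                              ≡⟨ cong (λ x → Σ< (divN n) (2 ^ Y + x)) (+-identityʳ (2 ^ Y)) ⟩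
    Σ< (divN n) (2 ^ Y + 2 ^ Y)                                    ≡⟨ Σ<-+ (divN n) (2 ^ Y) (2 ^ Y) ⟩
    Σ< (divN n) (2 ^ Y) + Σ< (λ i → divN n (2 ^ Y + i)) (2 ^ Y)    ≤⟨ +-mono-≤ (Σ<divN≤ n Y) dyadicBlock ⟩
    n * Y + n                                                      ≡⟨ +-comm (n * Y) n ⟩
    n + n * Y                                                      ≡⟨ *-suc n Y ⟨
    n * suc Y                                                      ∎
  where
  open ≤-Reasoning
  dyadicBlock : Σ< (λ i → divN n (2 ^ Y + i)) (2 ^ Y) ≤ n
  dyadicBlock = begin
    Σ< (λ i → divN n (2 ^ Y + i)) (2 ^ Y)   ≤⟨ Σ<-mono-≤ (2 ^ Y) (λ i _ → divN-antimono n (m^n>0 2 Y) (m≤m+n _ i)) ⟩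
    Σ< (λ _ → divN n (2 ^ Y)) (2 ^ Y)       ≡⟨ Σ<-const _ (2 ^ Y) ⟩
    2 ^ Y * divN n (2 ^ Y)                  ≤⟨ *-divN≤ n (2 ^ Y) ⟩
    n                                       ∎

σ-small : ℕ → ℕ → ℕ
σ-small Y n = Σ< (λ d → 𝟙 (d ≤? 2 ^ Y) * coDiv n d) (suc n)

σ-small≤ : ∀ n Y → σ-small Y n ≤ n * suc Y
σ-small≤ n Y = begin
    Σ< g (suc n)                                ≤⟨ truncate (suc n) ⟩
    Σ< g (suc (2 ^ Y))                          ≤⟨ Σ<-mono-≤ (suc (2 ^ Y)) (λ d _ →
                                                     ≤-trans (𝟙*n≤n (d ≤? 2 ^ Y) _) (coDiv≤divN n d)) ⟩
    Σ< (divN n) (2 ^ Y) + divN n (2 ^ Y)        ≤⟨ +-mono-≤ (Σ<divN≤ n Y) (m≤n*m _ (2 ^ Y) {{m^n≢0 2 Y}}) ⟩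
    n * Y + 2 ^ Y * divN n (2 ^ Y)              ≤⟨ +-monoʳ-≤ (n * Y) (*-divN≤ n (2 ^ Y)) ⟩
    n * Y + n                                   ≡⟨ +-comm (n * Y) n ⟩
    n + n * Y                                   ≡⟨ *-suc n Y ⟨
    n * suc Y                                   ∎
  where
  open ≤-Reasoning
  g = λ d → 𝟙 (d ≤? 2 ^ Y) * coDiv n d
  truncate : ∀ k → Σ< g k ≤ Σ< g (suc (2 ^ Y))
  truncate k with k ≤? suc (2 ^ Y)
  ... | yes k≤ = Σ<-monoʳ-≤ g k≤
  ... | no k≰ = ≤-reflexive (Σ<-vanishing g (<⇒≤ (≰⇒> k≰))
                  (λ i i> → cong (_* coDiv n i) (𝟙-no (i ≤? 2 ^ Y) (<⇒≱ i>))))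

bitLength : ℕ → ℕ
bitLength p = suc ⌊log₂ p ⌋

bits : List ℕ → ℕ → ℕ
bits S d = Σl (λ p → 𝟙 (p ∣? d) * bitLength p) S

∣Πl-id⇒≤2^bits : ∀ {S} d → DescendingPrimes S → d ∣ Πl id S → d ≤ 2 ^ bits S d
∣Πl-id⇒≤2^bits {S} d ds d∣P = begin
    d                                           ≤⟨ ∣Πl-id⇒≤Πl-radFactor d ds d∣P ⟩
    Πl (radFactor d) S                          ≤⟨ Πl-mono-≤ {xs = S} (All.tabulate (λ {p} _ → radFactor≤ p)) ⟩
    Πl (λ p → 2 ^ (𝟙 (p ∣? d) * bitLength p)) S ≡⟨ Πl-2^ _ S ⟩
    2 ^ bits S d                                ∎
  where
  open ≤-Reasoning
  radFactor≤ : ∀ p → radFactor d p ≤ 2 ^ (𝟙 (p ∣? d) * bitLength p)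
  radFactor≤ p with p ∣? d
  ... | yes _ = subst₂ _≤_ (sym (*-identityʳ p)) (cong (2 ^_) (sym (+-identityʳ (bitLength p))))
                  (<⇒≤ (n<2^[1+⌊log₂n⌋] p))
  ... | no _ = ≤-refl

Σ<multiples-coDiv≤ : ∀ n p → 1 ≤ n → 1 ≤ p → p ∣ n →
  Σ< (λ d → 𝟙 (p ∣? d) * coDiv n d) (suc n) * n ≤ divN n p * σ n
Σ<multiples-coDiv≤ n p n≥1 p≥1 p∣n =
  subst (λ x → Σ< (λ d → 𝟙 (p ∣? d) * coDiv x d) (suc x) * x ≤ n′ * σ x) n≡p*n′ bound
  where
  n′ = divN n p
  n≡p*n′ : p * n′ ≡ n
  n≡p*n′ = trans (*-comm p n′) (divN-exact p∣n)
  n′≥1 : 1 ≤ n′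
  n′≥1 with n′ | n≡p*n′
  ... | zero | p*0≡n = ⊥-elim (<⇒≢ n≥1 (trans (sym (*-zeroʳ p)) p*0≡n))
  ... | suc _ | _ = s≤s z≤n
  bound : Σ< (λ d → 𝟙 (p ∣? d) * coDiv (p * n′) d) (suc (p * n′)) * (p * n′) ≤ n′ * σ (p * n′)
  bound = begin
      Σ< (λ d → 𝟙 (p ∣? d) * coDiv (p * n′) d) (suc (p * n′)) * (p * n′)
                                         ≡⟨ cong (_* (p * n′)) (σ-multiples p n′ p≥1 n′≥1) ⟩
      σ n′ * (p * n′)                    ≡⟨ reorder (σ n′) p n′ ⟩
      n′ * (p * σ n′)                    ≤⟨ *-monoʳ-≤ n′ (≤-trans (*-σ≤ p n′ p≥1 (λ _ → 1) (λ _ _ → ≤-refl))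
                                              (≤-reflexive (Σ<-cong (suc (p * n′)) (λ d _ → *-identityˡ _)))) ⟩
      n′ * σ (p * n′)                    ∎
    where
    open ≤-Reasoning
    reorder : ∀ a b c → a * (b * c) ≡ c * (b * a)
    reorder = solve-∀

logWeight : List ℕ → ℕ → ℕ
logWeight S n = Σl (λ p → bitLength p * divN n p) S

σ-bits : List ℕ → ℕ → ℕ
σ-bits S n = Σ< (λ d → bits S d * coDiv n d) (suc n)

module _ {S} (ds : DescendingPrimes S) where

  private
    P = Πl id S

  suc[Y]*σ≤ : ∀ Y → suc Y * σ P ≤ suc Y * σ-small Y P + σ-bits S P
  suc[Y]*σ≤ Y = begin
      suc Y * σ P                                   ≡⟨ Σ<-*ˡ (suc Y) (coDiv P) (suc P) ⟨
      Σ< (λ d → suc Y * coDiv P d) (suc P)          ≤⟨ Σ<-mono-≤ (suc P) (λ d _ → termwise d) ⟩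
      Σ< (λ d → suc Y * (𝟙 (d ≤? 2 ^ Y) * coDiv P d) + bits S d * coDiv P d) (suc P)
                                                    ≡⟨ Σ<-distrib-+ _ _ (suc P) ⟩
      Σ< (λ d → suc Y * (𝟙 (d ≤? 2 ^ Y) * coDiv P d)) (suc P) + σ-bits S P
                                                    ≡⟨ cong (_+ σ-bits S P) (Σ<-*ˡ (suc Y) _ (suc P)) ⟩
      suc Y * σ-small Y P + σ-bits S P              ∎
    where
    open ≤-Reasoning
    termwise : ∀ d → suc Y * coDiv P d ≤ suc Y * (𝟙 (d ≤? 2 ^ Y) * coDiv P d) + bits S d * coDiv P d
    termwise d with d ≤? 2 ^ Y
    ... | yes _ = ≤-trans (≤-reflexive (cong (suc Y *_) (sym (*-identityˡ (coDiv P d))))) (m≤m+n _ _)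
    ... | no d≰ with d ∣? P
    ...   | no _ = ≤-trans (≤-reflexive (*-zeroʳ (suc Y))) z≤n
    ...   | yes d∣P = ≤-trans (*-monoˡ-≤ (1 * divN P d) Y<bits) (m≤n+m _ _)
      where
      Y<bits : suc Y ≤ bits S d
      Y<bits with suc Y ≤? bits S d
      ... | yes Y< = Y<
      ... | no Y≮ = ⊥-elim (d≰ (≤-trans (∣Πl-id⇒≤2^bits d ds d∣P) (^-monoʳ-≤ 2 (≮⇒≥ Y≮))))

  σ-bits*P≤ : σ-bits S P * P ≤ logWeight S P * σ P
  σ-bits*P≤ = begin
      σ-bits S P * P                ≡⟨ trans (cong (_* P) σ-bits≡) (Σl-*ʳ _ P S) ⟩
      Σl (λ p → bitLength p * onMultiples p * P) S
                                    ≤⟨ Σl-All-mono-≤ {xs = S} (All.zipWith (λ (p∣P , pp) → perPrime p∣P pp) (∈⇒∣Πl-id S , descending⇒primes ds)) ⟩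
      Σl (λ p → bitLength p * divN P p * σ P) S
                                    ≡⟨ Σl-*ʳ _ (σ P) S ⟨
      logWeight S P * σ P           ∎
    where
    open ≤-Reasoning
    onMultiples : ℕ → ℕ
    onMultiples p = Σ< (λ d → 𝟙 (p ∣? d) * coDiv P d) (suc P)
    reorder : ∀ a b c → a * b * c ≡ b * (a * c)
    reorder = solve-∀
    σ-bits≡ : σ-bits S P ≡ Σl (λ p → bitLength p * onMultiples p) S
    σ-bits≡ = begin-equality
        Σ< (λ d → bits S d * coDiv P d) (suc P)
          ≡⟨ Σ<-cong (suc P) (λ d _ → trans (Σl-*ʳ _ (coDiv P d) S) (Σl-cong S (λ p → reorder (𝟙 (p ∣? d)) (bitLength p) (coDiv P d)))) ⟩
        Σ< (λ d → Σl (λ p → bitLength p * (𝟙 (p ∣? d) * coDiv P d)) S) (suc P)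
          ≡⟨ Σl-Σ<-comm (λ p d → bitLength p * (𝟙 (p ∣? d) * coDiv P d)) S (suc P) ⟨
        Σl (λ p → Σ< (λ d → bitLength p * (𝟙 (p ∣? d) * coDiv P d)) (suc P)) S
          ≡⟨ Σl-cong S (λ p → Σ<-*ˡ (bitLength p) _ (suc P)) ⟩
        Σl (λ p → bitLength p * onMultiples p) S ∎
    perPrime : ∀ {p} → p ∣ P → Prime p → bitLength p * onMultiples p * P ≤ bitLength p * divN P p * σ P
    perPrime {p} p∣P pp = begin
        bitLength p * onMultiples p * P      ≡⟨ *-assoc (bitLength p) (onMultiples p) P ⟩
        bitLength p * (onMultiples p * P)    ≤⟨ *-monoʳ-≤ (bitLength p) (Σ<multiples-coDiv≤ P p (Πl-id≥1 (descending⇒primes ds)) (prime⇒≥1 pp) p∣P) ⟩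
        bitLength p * (divN P p * σ P)       ≡⟨ *-assoc (bitLength p) (divN P p) (σ P) ⟨
        bitLength p * divN P p * σ P         ∎

  -- From (Y + 1) σ ≤ (Y + 1) σ-small + σ-bits and 2 σ-bits P ≤ Y P σ: (Y + 2) σ ≤ 2 (Y + 1) σ-small.
  rankin : ∀ Y → 2 * logWeight S P ≤ Y * P → σ P ≤ 2 * (P * suc Y)
  rankin Y 2W≤YP = ≤-trans σ≤2small (*-monoʳ-≤ 2 (σ-small≤ P Y))
    where
    open ≤-Reasoning
    small = σ-small Y P
    combined : (Y + 2) * σ P * P + Y * P * σ P ≤ 2 * suc Y * small * P + Y * P * σ P
    combined = begin
        (Y + 2) * σ P * P + Y * P * σ P             ≡⟨ expand Y (σ P) P ⟩
        2 * (suc Y * σ P) * P                       ≤⟨ *-monoˡ-≤ P (*-monoʳ-≤ 2 (suc[Y]*σ≤ Y)) ⟩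
        2 * (suc Y * small + σ-bits S P) * P        ≡⟨ distribute (suc Y) small (σ-bits S P) P ⟩
        2 * suc Y * small * P + 2 * (σ-bits S P * P)
                                                    ≤⟨ +-monoʳ-≤ (2 * suc Y * small * P) (*-monoʳ-≤ 2 σ-bits*P≤) ⟩
        2 * suc Y * small * P + 2 * (logWeight S P * σ P)
                                                    ≡⟨ cong (2 * suc Y * small * P +_) (*-assoc 2 (logWeight S P) (σ P)) ⟨
        2 * suc Y * small * P + 2 * logWeight S P * σ P
                                                    ≤⟨ +-monoʳ-≤ (2 * suc Y * small * P) (*-monoˡ-≤ (σ P) 2W≤YP) ⟩
        2 * suc Y * small * P + Y * P * σ P         ∎
      where
      expand : ∀ Y σ P → (Y + 2) * σ * P + Y * P * σ ≡ 2 * ((1 + Y) * σ) * P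
      expand = solve-∀
      distribute : ∀ a b c d → 2 * (a * b + c) * d ≡ 2 * a * b * d + 2 * (c * d)
      distribute = solve-∀
    σ≤2small : σ P ≤ 2 * small
    σ≤2small = *-cancelʳ-≤′ (σ P) (2 * small) (Y + 2) (≤-trans (s≤s z≤n) (m≤n+m 2 Y)) (begin
        σ P * (Y + 2)                ≡⟨ *-comm (σ P) (Y + 2) ⟩
        (Y + 2) * σ P                ≤⟨ *-cancelʳ-≤′ _ _ P (Πl-id≥1 (descending⇒primes ds)) (+-cancelʳ-≤ (Y * P * σ P) _ _ combined) ⟩
        2 * suc Y * small            ≡⟨ rearrange Y small ⟩
        (Y + 1) * (2 * small)        ≤⟨ *-monoˡ-≤ (2 * small) (+-monoʳ-≤ Y (s≤s z≤n)) ⟩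
        (Y + 2) * (2 * small)        ≡⟨ *-comm (Y + 2) (2 * small) ⟩
        2 * small * (Y + 2)          ∎)
      where
      rearrange : ∀ Y s → 2 * (1 + Y) * s ≡ (Y + 1) * (2 * s)
      rearrange = solve-∀

-- m / φ(m) = O(log log m)

x≤2*p*#multiples : ∀ p x → 1 ≤ p → p ≤ x → x ≤ 2 * p * #multiples p x
x≤2*p*#multiples (suc p′) x _ p≤x = begin
    x                       ≡⟨ m≡m%n+[m/n]*n x p ⟩
    x % p + Q * p           ≤⟨ +-monoˡ-≤ (Q * p) (<⇒≤ (m%n<n x p)) ⟩
    p + Q * p               ≤⟨ +-monoˡ-≤ (Q * p) (m≤n*m p Q {{>-nonZero (m≥n⇒m/n>0 p≤x)}}) ⟩
    Q * p + Q * p           ≡⟨ double Q p ⟩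
    2 * p * Q               ≤⟨ *-monoʳ-≤ (2 * p) Q≤#multiples ⟩
    2 * p * #multiples p x  ∎
  where
  open ≤-Reasoning
  p = suc p′
  Q = x / p
  Q≤#multiples : Q ≤ #multiples p x
  Q≤#multiples = subst (_≤ #multiples p x) (#multiples≡ p (s≤s z≤n) Q)
    (Σ<-monoʳ-≤ (λ i → 𝟙 (p ∣? suc i)) (subst (_≤ x) (*-comm Q p) (m/n*n≤m x p)))
  double : ∀ Q p → Q * p + Q * p ≡ 2 * p * Q
  double = solve-∀

Σl-log₂≤log₂ : ∀ {S} t → DescendingPrimes S → 1 ≤ t → Σl (λ p → 𝟙 (p ∣? t) * ⌊log₂ p ⌋) S ≤ ⌊log₂ t ⌋
Σl-log₂≤log₂ {S} t ds t≥1 = 2^m≤n⇒m≤⌊log₂n⌋ _ t (begin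
    2 ^ Σl (λ p → 𝟙 (p ∣? t) * ⌊log₂ p ⌋) S      ≡⟨ Πl-2^ _ S ⟨
    Πl (λ p → 2 ^ (𝟙 (p ∣? t) * ⌊log₂ p ⌋)) S    ≤⟨ Πl-mono-≤ (All.map radFactor≥ (descending⇒primes ds)) ⟩
    Πl (radFactor t) S                           ≤⟨ ∣⇒≤′ t≥1 (Πl-radFactor∣ t ds) ⟩
    t                                            ∎)
  where
  open ≤-Reasoning
  radFactor≥ : ∀ {p} → Prime p → 2 ^ (𝟙 (p ∣? t) * ⌊log₂ p ⌋) ≤ radFactor t p
  radFactor≥ {p} pp with p ∣? t
  ... | yes _ = subst₂ _≤_ (cong (2 ^_) (sym (+-identityʳ ⌊log₂ p ⌋))) (sym (*-identityʳ p))
                  (2^⌊log₂n⌋≤n p (prime⇒≥1 pp))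
  ... | no _ = ≤-refl

chebyshev : ∀ {S} J → DescendingPrimes S →
  Σl (λ p → 𝟙 (p ≤? 2 ^ J) * ⌊log₂ p ⌋ * #multiples p (2 ^ J)) S ≤ 2 ^ J * J
chebyshev {S} J ds = begin
    Σl (λ p → 𝟙 (p ≤? x) * ⌊log₂ p ⌋ * #multiples p x) S
      ≡⟨ Σl-cong S (λ p → Σ<-*ˡ (𝟙 (p ≤? x) * ⌊log₂ p ⌋) _ x) ⟨
    Σl (λ p → Σ< (λ i → 𝟙 (p ≤? x) * ⌊log₂ p ⌋ * 𝟙 (p ∣? suc i)) x) S
      ≡⟨ Σl-Σ<-comm (λ p i → 𝟙 (p ≤? x) * ⌊log₂ p ⌋ * 𝟙 (p ∣? suc i)) S x ⟩
    Σ< (λ i → Σl (λ p → 𝟙 (p ≤? x) * ⌊log₂ p ⌋ * 𝟙 (p ∣? suc i)) S) x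
      ≤⟨ Σ<-mono-≤ x (λ i i<x → ≤-trans (Σl-mono-≤ S (λ p → dropSmall p (suc i)))
                                 (≤-trans (Σl-log₂≤log₂ (suc i) ds (s≤s z≤n))
                                   (subst (⌊log₂ suc i ⌋ ≤_) (⌊log₂[2^n]⌋≡n J) (⌊log₂⌋-mono-≤ i<x)))) ⟩
    Σ< (λ _ → J) x                       ≡⟨ Σ<-const J x ⟩
    x * J                                ∎
  where
  open ≤-Reasoning
  x = 2 ^ J
  dropSmall : ∀ p t → 𝟙 (p ≤? x) * ⌊log₂ p ⌋ * 𝟙 (p ∣? t) ≤ 𝟙 (p ∣? t) * ⌊log₂ p ⌋
  dropSmall p t = ≤-trans (≤-reflexive (*-comm _ (𝟙 (p ∣? t))))
                    (*-monoʳ-≤ (𝟙 (p ∣? t)) (𝟙*n≤n (p ≤? x) ⌊log₂ p ⌋))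

logWeight-small≤ : ∀ {S} J P → DescendingPrimes S → All (_∣ P) S → 1 ≤ J →
  Σl (λ p → 𝟙 (p ≤? 2 ^ J) * (bitLength p * divN P p)) S ≤ 4 * J * P
logWeight-small≤ {S} J P ds S∣P J≥1 = *-cancelʳ-≤′ _ (4 * J * P) x (m^n>0 2 J) (begin
    Σl (λ p → 𝟙 (p ≤? x) * (bitLength p * divN P p)) S * x
                                         ≡⟨ Σl-*ʳ _ x S ⟩
    Σl (λ p → 𝟙 (p ≤? x) * (bitLength p * divN P p) * x) S
                                         ≤⟨ Σl-All-mono-≤ {xs = S} (All.zipWith (λ (pp , p∣P) → perPrime pp p∣P) (descending⇒primes ds , S∣P)) ⟩
    Σl (λ p → 4 * P * (𝟙 (p ≤? x) * ⌊log₂ p ⌋ * #multiples p x)) S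
                                         ≡⟨ Σl-*ˡ (4 * P) _ S ⟩
    4 * P * Σl (λ p → 𝟙 (p ≤? x) * ⌊log₂ p ⌋ * #multiples p x) S
                                         ≤⟨ *-monoʳ-≤ (4 * P) (chebyshev J ds) ⟩
    4 * P * (x * J)                      ≡⟨ reorder P x J ⟩
    4 * J * P * x                        ∎)
  where
  open ≤-Reasoning
  x = 2 ^ J
  reorder : ∀ P x J → 4 * P * (x * J) ≡ 4 * J * P * x
  reorder = solve-∀
  perPrime : ∀ {p} → Prime p → p ∣ P →
    𝟙 (p ≤? x) * (bitLength p * divN P p) * x ≤ 4 * P * (𝟙 (p ≤? x) * ⌊log₂ p ⌋ * #multiples p x)
  perPrime {p} pp p∣P with p ≤? x
  ... | no _ = z≤n
  ... | yes p≤x = begin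
      1 * (bitLength p * divN P p) * x          ≡⟨ cong (_* x) (*-identityˡ (bitLength p * divN P p)) ⟩
      bitLength p * divN P p * x                ≤⟨ *-monoˡ-≤ x (*-monoˡ-≤ (divN P p) bitLength≤2b) ⟩
      2 * b * divN P p * x                      ≤⟨ *-monoʳ-≤ (2 * b * divN P p) (x≤2*p*#multiples p x (prime⇒≥1 pp) p≤x) ⟩
      2 * b * divN P p * (2 * p * #multiples p x) ≡⟨ regroup b (divN P p) p (#multiples p x) ⟩
      4 * (divN P p * p) * (b * #multiples p x) ≡⟨ cong (λ y → 4 * y * (b * #multiples p x)) (divN-exact p∣P) ⟩
      4 * P * (b * #multiples p x)              ≡⟨ cong (λ y → 4 * P * (y * #multiples p x)) (*-identityˡ b) ⟨
      4 * P * (1 * b * #multiples p x)          ∎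
    where
    b = ⌊log₂ p ⌋
    bitLength≤2b : bitLength p ≤ 2 * b
    bitLength≤2b = subst (suc b ≤_) (cong (b +_) (sym (+-identityʳ b)))
      (subst (_≤ b + b) (+-comm b 1) (+-monoʳ-≤ b (2^m≤n⇒m≤⌊log₂n⌋ 1 p (prime⇒≥2 pp))))
    regroup : ∀ b d p c → 2 * b * d * (2 * p * c) ≡ 4 * (d * p) * (b * c)
    regroup = solve-∀

suc[J+e]*2^J≤suc[J]*2^[J+e] : ∀ J e → suc (J + e) * 2 ^ J ≤ suc J * 2 ^ (J + e)
suc[J+e]*2^J≤suc[J]*2^[J+e] J zero = subst (λ k → suc k * 2 ^ J ≤ suc J * 2 ^ k) (sym (+-identityʳ J)) ≤-refl
suc[J+e]*2^J≤suc[J]*2^[J+e] J (suc e) = begin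
    suc (J + suc e) * 2 ^ J           ≤⟨ *-monoˡ-≤ (2 ^ J) halve ⟩
    2 * suc (J + e) * 2 ^ J           ≡⟨ *-assoc 2 (suc (J + e)) (2 ^ J) ⟩
    2 * (suc (J + e) * 2 ^ J)         ≤⟨ *-monoʳ-≤ 2 (suc[J+e]*2^J≤suc[J]*2^[J+e] J e) ⟩
    2 * (suc J * 2 ^ (J + e))         ≡⟨ swap (suc J) (2 ^ (J + e)) ⟩
    suc J * (2 * 2 ^ (J + e))         ≡⟨ cong (λ k → suc J * 2 ^ k) (+-suc J e) ⟨
    suc J * 2 ^ (J + suc e)           ∎
  where
  open ≤-Reasoning
  swap : ∀ a b → 2 * (a * b) ≡ a * (2 * b)
  swap = solve-∀
  halve : suc (J + suc e) ≤ 2 * suc (J + e)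
  halve = subst₂ _≤_ (cong suc (sym (+-suc J e))) (cong (suc (J + e) +_) (sym (+-identityʳ (suc (J + e)))))
            (s≤s (m≤n+m (suc (J + e)) (J + e)))

bitLength*2^J≤ : ∀ J p → 2 ^ J < p → bitLength p * 2 ^ J ≤ suc J * p
bitLength*2^J≤ J p 2^J<p with m≤n⇒∃[o]m+o≡n (2^m≤n⇒m≤⌊log₂n⌋ J p (<⇒≤ 2^J<p))
... | e , J+e≡ = begin
    suc ⌊log₂ p ⌋ * 2 ^ J        ≡⟨ cong (λ k → suc k * 2 ^ J) J+e≡ ⟨
    suc (J + e) * 2 ^ J          ≤⟨ suc[J+e]*2^J≤suc[J]*2^[J+e] J e ⟩
    suc J * 2 ^ (J + e)          ≡⟨ cong (λ k → suc J * 2 ^ k) J+e≡ ⟩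
    suc J * 2 ^ ⌊log₂ p ⌋        ≤⟨ *-monoʳ-≤ (suc J) (2^⌊log₂n⌋≤n p (≤-trans (m^n>0 2 J) (<⇒≤ 2^J<p))) ⟩
    suc J * p                    ∎
  where open ≤-Reasoning

-- Each prime above 2^J contributes a factor above 2^J to Π S ≤ 2^2^J.
#large*J≤2^J : ∀ {S} J → DescendingPrimes S → Πl id S ≤ 2 ^ 2 ^ J → Σl (λ p → 𝟙 (¬? (p ≤? 2 ^ J))) S * J ≤ 2 ^ J
#large*J≤2^J {S} J ds ΠS≤ = 2^-cancel-≤ (t * J) x (begin
    2 ^ (t * J)                                   ≡⟨ cong (2 ^_) (Σl-*ʳ (λ p → 𝟙 (¬? (p ≤? x))) J S) ⟩
    2 ^ Σl (λ p → 𝟙 (¬? (p ≤? x)) * J) S          ≡⟨ Πl-2^ _ S ⟨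
    Πl (λ p → 2 ^ (𝟙 (¬? (p ≤? x)) * J)) S        ≤⟨ Πl-mono-≤ (All.map factor≤ (descending⇒primes ds)) ⟩
    Πl id S                                       ≤⟨ ΠS≤ ⟩
    2 ^ x                                         ∎)
  where
  open ≤-Reasoning
  x = 2 ^ J
  t = Σl (λ p → 𝟙 (¬? (p ≤? x))) S
  factor≤ : ∀ {p} → Prime p → 2 ^ (𝟙 (¬? (p ≤? x)) * J) ≤ p
  factor≤ {p} pp with p ≤? x
  ... | yes _ = prime⇒≥1 pp
  ... | no p≰x = subst (_≤ p) (cong (2 ^_) (sym (+-identityʳ J))) (<⇒≤ (≰⇒> p≰x))

logWeight-large≤ : ∀ {S} J P → DescendingPrimes S → All (_∣ P) S → 1 ≤ J → Πl id S ≤ 2 ^ 2 ^ J →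
  Σl (λ p → 𝟙 (¬? (p ≤? 2 ^ J)) * (bitLength p * divN P p)) S ≤ 2 * P
logWeight-large≤ {S} J P ds S∣P J≥1 ΠS≤ = *-cancelʳ-≤′ _ (2 * P) x (m^n>0 2 J) (begin
    Σl (λ p → 𝟙 (¬? (p ≤? x)) * (bitLength p * divN P p)) S * x
                                         ≡⟨ Σl-*ʳ _ x S ⟩
    Σl (λ p → 𝟙 (¬? (p ≤? x)) * (bitLength p * divN P p) * x) S
                                         ≤⟨ Σl-All-mono-≤ {xs = S} (All.zipWith (λ (pp , p∣P) → perPrime pp p∣P) (descending⇒primes ds , S∣P)) ⟩
    Σl (λ p → 𝟙 (¬? (p ≤? x)) * (suc J * P)) S
                                         ≡⟨ Σl-*ʳ _ (suc J * P) S ⟨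
    t * (suc J * P)                      ≡⟨ expand t J P ⟩
    t * J * P + t * P                    ≤⟨ +-monoʳ-≤ (t * J * P) (*-monoˡ-≤ P (m≤m*n t J {{>-nonZero J≥1}})) ⟩
    t * J * P + t * J * P                ≤⟨ +-mono-≤ (*-monoˡ-≤ P t*J≤x) (*-monoˡ-≤ P t*J≤x) ⟩
    x * P + x * P                        ≡⟨ collect x P ⟩
    2 * P * x                            ∎)
  where
  open ≤-Reasoning
  x = 2 ^ J
  t = Σl (λ p → 𝟙 (¬? (p ≤? x))) S
  t*J≤x = #large*J≤2^J J ds ΠS≤
  expand : ∀ t J P → t * (suc J * P) ≡ t * J * P + t * P
  expand = solve-∀
  collect : ∀ x P → x * P + x * P ≡ 2 * P * x
  collect = solve-∀
  perPrime : ∀ {p} → Prime p → p ∣ P →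
    𝟙 (¬? (p ≤? x)) * (bitLength p * divN P p) * x ≤ 𝟙 (¬? (p ≤? x)) * (suc J * P)
  perPrime {p} pp p∣P with p ≤? x
  ... | yes _ = z≤n
  ... | no p≰x = begin
      1 * (bitLength p * divN P p) * x     ≡⟨ reorder (bitLength p) (divN P p) x ⟩
      bitLength p * x * divN P p           ≤⟨ *-monoˡ-≤ (divN P p) (bitLength*2^J≤ J p (≰⇒> p≰x)) ⟩
      suc J * p * divN P p                 ≡⟨ *-assoc (suc J) p (divN P p) ⟩
      suc J * (p * divN P p)               ≡⟨ cong (suc J *_) (trans (*-comm p (divN P p)) (divN-exact p∣P)) ⟩
      suc J * P                            ≡⟨ *-identityˡ _ ⟨
      1 * (suc J * P)                      ∎
    where
    reorder : ∀ a b c → 1 * (a * b) * c ≡ a * c * b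
    reorder = solve-∀

2*logWeight≤ : ∀ {S} J → DescendingPrimes S → 1 ≤ J → Πl id S ≤ 2 ^ 2 ^ J →
  2 * logWeight S (Πl id S) ≤ (8 * J + 4) * Πl id S
2*logWeight≤ {S} J ds J≥1 ΠS≤ = begin
    2 * logWeight S P                  ≡⟨ cong (2 *_) (trans (Σl-cong S (λ p → sym (𝟙-split (p ≤? x) (w p)))) (Σl-distrib-+ _ _ S)) ⟩
    2 * (Σl (λ p → 𝟙 (p ≤? x) * w p) S + Σl (λ p → 𝟙 (¬? (p ≤? x)) * w p) S)
                                       ≤⟨ *-monoʳ-≤ 2 (+-mono-≤ (logWeight-small≤ J P ds (∈⇒∣Πl-id S) J≥1)
                                                                (logWeight-large≤ J P ds (∈⇒∣Πl-id S) J≥1 ΠS≤)) ⟩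
    2 * (4 * J * P + 2 * P)            ≡⟨ collect J P ⟩
    (8 * J + 4) * P                    ∎
  where
  open ≤-Reasoning
  P = Πl id S
  x = 2 ^ J
  w = λ p → bitLength p * divN P p
  collect : ∀ J P → 2 * (4 * J * P + 2 * P) ≡ (8 * J + 4) * P
  collect = solve-∀

-- Π p² / (p² − 1) over primes p ≤ k is at most the telescoping Π_{j=2}^{k} j² / (j² − 1) = 2 k / (k + 1).
suc[k]*Πsquare≤2k*Π[square∸1] : ∀ {S} k → DescendingPrimes S → All (_≤ k) S → 1 ≤ k →
  suc k * Πl (λ p → p * p) S ≤ 2 * k * Πl (λ p → pred p * suc p) S
suc[k]*Πsquare≤2k*Π[square∸1] (suc k) [] [] _ = subst₂ _≤_ (sym (*-identityʳ (suc (suc k))))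
  (sym (trans (*-identityʳ (2 * suc k)) (cong (suc k +_) (+-identityʳ (suc k)))))
  (s≤s (m≤n+m (suc k) k))
suc[k]*Πsquare≤2k*Π[square∸1] {suc q′ ∷ S} k (cons pq ls ds) (q≤k ∷ _) k≥1 with prime⇒≥2 pq
... | s≤s q′≥1 = begin
    suc k * (q * q * B)                ≡⟨ regroup (suc k) q B ⟩
    (suc k * q) * (q * B)              ≤⟨ *-monoˡ-≤ (q * B) shift ⟩
    (k * suc q) * (q * B)              ≡⟨ *-assoc k (suc q) (q * B) ⟩
    k * (suc q * (q * B))              ≤⟨ *-monoʳ-≤ k (*-monoʳ-≤ (suc q) IH) ⟩
    k * (suc q * (2 * q′ * A))         ≡⟨ collect k (suc q) q′ A ⟩
    2 * k * (q′ * suc q * A)           ∎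
  where
  open ≤-Reasoning
  q = suc q′
  B = Πl (λ p → p * p) S
  A = Πl (λ p → pred p * suc p) S
  IH : q * B ≤ 2 * q′ * A
  IH = suc[k]*Πsquare≤2k*Π[square∸1] q′ ds (All.map (λ { (s≤s p≤q′) → p≤q′ }) ls) q′≥1
  regroup : ∀ a b c → a * (b * b * c) ≡ (a * b) * (b * c)
  regroup = solve-∀
  collect : ∀ a b c d → a * (b * (2 * c * d)) ≡ 2 * a * (c * b * d)
  collect = solve-∀
  shift : suc k * q ≤ k * suc q
  shift = subst (q + k * q ≤_) (sym (*-suc k q)) (+-monoˡ-≤ (k * q) q≤k)

rad²≤2*Πpred*Πsuc : ∀ m → 1 ≤ m →
  Πl id (primeDivisors m) * Πl id (primeDivisors m) ≤ 2 * (Πl pred (primeDivisors m) * Πl suc (primeDivisors m))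
rad²≤2*Πpred*Πsuc m m≥1 = *-cancelʳ-≤′ (P * P) (2 * (Πpred * Πsuc)) m m≥1 (begin
    P * P * m                             ≡⟨ *-comm (P * P) m ⟩
    m * (P * P)                           ≤⟨ *-monoˡ-≤ (P * P) (n≤1+n m) ⟩
    suc m * (P * P)                       ≡⟨ cong (suc m *_) (Πl-distrib-* id id S) ⟨
    suc m * Πl (λ p → p * p) S            ≤⟨ suc[k]*Πsquare≤2k*Π[square∸1] m (primeDivisors-descending m) (primeDivisors-≤ m) m≥1 ⟩
    2 * m * Πl (λ p → pred p * suc p) S   ≡⟨ cong (2 * m *_) (Πl-distrib-* pred suc S) ⟩
    2 * m * (Πpred * Πsuc)                ≡⟨ reorder m (Πpred * Πsuc) ⟩
    2 * (Πpred * Πsuc) * m                ∎)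
  where
  open ≤-Reasoning
  S = primeDivisors m
  P = Πl id S
  Πpred = Πl pred S
  Πsuc = Πl suc S
  reorder : ∀ m a → 2 * m * a ≡ 2 * a * m
  reorder = solve-∀

totient-lower-bound : ∀ J m → 1 ≤ J → 1 ≤ m → m ≤ 2 ^ 2 ^ J → m ≤ 4 * (8 * J + 5) * φ m
totient-lower-bound J m J≥1 m≥1 m≤ = *-cancelʳ-≤′ m (4 * (8 * J + 5) * φ m) P P≥1 (begin
    m * P                              ≤⟨ *-monoʳ-≤ m P≤ ⟩
    m * (4 * suc Y * Πpred)            ≡⟨ regroup m (suc Y) Πpred ⟩
    4 * suc Y * (m * Πpred)            ≤⟨ *-monoʳ-≤ (4 * suc Y) (m*Πpred≤φ*rad m m≥1) ⟩
    4 * suc Y * (φ m * P)              ≡⟨ *-assoc (4 * suc Y) (φ m) P ⟨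
    4 * suc Y * φ m * P                ≡⟨ cong (λ k → 4 * k * φ m * P) (+-suc (8 * J) 4) ⟨
    4 * (8 * J + 5) * φ m * P          ∎)
  where
  open ≤-Reasoning
  S = primeDivisors m
  ds = primeDivisors-descending m
  P = Πl id S
  Πpred = Πl pred S
  Πsuc = Πl suc S
  P≥1 = Πl-id≥1 (descending⇒primes ds)
  Y = 8 * J + 4
  regroup : ∀ m a b → m * (4 * a * b) ≡ 4 * a * (m * b)
  regroup = solve-∀
  Πsuc≤ : Πsuc ≤ 2 * (P * suc Y)
  Πsuc≤ = ≤-trans (Πl-suc≤σ ds) (rankin ds Y (2*logWeight≤ J ds J≥1 (≤-trans (∣⇒≤′ m≥1 (rad∣ m)) m≤)))
  P≤ : P ≤ 4 * suc Y * Πpred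
  P≤ = *-cancelʳ-≤′ P (4 * suc Y * Πpred) P P≥1 (begin
      P * P                              ≤⟨ rad²≤2*Πpred*Πsuc m m≥1 ⟩
      2 * (Πpred * Πsuc)                 ≤⟨ *-monoʳ-≤ 2 (*-monoʳ-≤ Πpred Πsuc≤) ⟩
      2 * (Πpred * (2 * (P * suc Y)))    ≡⟨ collect Πpred P (suc Y) ⟩
      4 * suc Y * Πpred * P              ∎)
    where
    collect : ∀ a P y → 2 * (a * (2 * (P * y))) ≡ 4 * y * a * P
    collect = solve-∀

-- Counting by injections; small residues of a e mod m

#occurrences≡0 : ∀ {xs : List ℕ} v → All (v ≢_) xs → Σl (λ y → 𝟙 (y ≟ v)) xs ≡ 0
#occurrences≡0 v [] = refl
#occurrences≡0 {x ∷ xs} v (v≢x ∷ vs) = cong₂ _+_ (𝟙-no (x ≟ v) (v≢x ∘ sym)) (#occurrences≡0 v vs)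

unique⇒#occurrences≤1 : ∀ {xs : List ℕ} v → Unique xs → Σl (λ y → 𝟙 (y ≟ v)) xs ≤ 1
unique⇒#occurrences≤1 v [] = z≤n
unique⇒#occurrences≤1 {x ∷ xs} v (x∉xs ∷ u) with x ≟ v
... | yes refl = ≤-reflexive (cong suc (#occurrences≡0 x x∉xs))
... | no _ = unique⇒#occurrences≤1 v u

Σ<-𝟙≟≡1 : ∀ {y} N → y < N → Σ< (λ v → 𝟙 (y ≟ v)) N ≡ 1
Σ<-𝟙≟≡1 {y} (suc N) y<1+N with m<1+n⇒m<n∨m≡n y<1+N
... | inj₁ y<N = cong₂ _+_ (Σ<-𝟙≟≡1 N y<N) (𝟙-no (y ≟ N) (<⇒≢ y<N))
... | inj₂ refl = cong₂ _+_ (Σ<-zero y (λ v v<y → 𝟙-no (y ≟ v) (>⇒≢ v<y))) (𝟙-yes (y ≟ y) refl)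

unique⇒length≤ : ∀ {ys : List ℕ} N → Unique ys → All (_< N) ys → length ys ≤ N
unique⇒length≤ {ys} N u ys<N = begin
    length ys                                     ≡⟨ trans (Σl-const 1 ys) (*-identityʳ (length ys)) ⟨
    Σl (λ _ → 1) ys                               ≡⟨ oneHots ys<N ⟨
    Σl (λ y → Σ< (λ v → 𝟙 (y ≟ v)) N) ys          ≡⟨ Σl-Σ<-comm (λ y v → 𝟙 (y ≟ v)) ys N ⟩
    Σ< (λ v → Σl (λ y → 𝟙 (y ≟ v)) ys) N          ≤⟨ Σ<-mono-≤ N (λ v _ → unique⇒#occurrences≤1 v u) ⟩
    Σ< (λ _ → 1) N                                ≡⟨ trans (Σ<-const 1 N) (*-identityʳ N) ⟩
    N                                             ∎
  where
  open ≤-Reasoning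
  oneHots : ∀ {ys} → All (_< N) ys → Σl (λ y → Σ< (λ v → 𝟙 (y ≟ v)) N) ys ≡ Σl (λ _ → 1) ys
  oneHots [] = refl
  oneHots (y<N ∷ ys<N) = cong₂ _+_ (Σ<-𝟙≟≡1 N y<N) (oneHots ys<N)

map-unique : ∀ {P : ℕ → Set} (f : ℕ → ℕ) {xs} → Unique xs → All P xs →
  (∀ {a b} → P a → P b → f a ≡ f b → a ≡ b) → Unique (map f xs)
map-unique f [] [] _ = []
map-unique f (x∉xs ∷ u) (px ∷ ps) inj =
  All.map⁺ (All.zipWith (λ (x≢y , py) → x≢y ∘ inj px py) (x∉xs , ps)) ∷ map-unique f u ps inj

#≤-injection : ∀ {P : ℕ → Set} (P? : Decidable P) M N (f : ℕ → ℕ) →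
  (∀ {a} → a < M → P a → f a < N) →
  (∀ {a b} → a < M → b < M → P a → P b → f a ≡ f b → a ≡ b) →
  Σ< (𝟙 ∘ P?) M ≤ N
#≤-injection {P} P? M N f f<N inj = begin
    Σ< (𝟙 ∘ P?) M                  ≡⟨ Σl-upTo _ M ⟨
    Σl (𝟙 ∘ P?) (upTo M)           ≡⟨ length-filter P? (upTo M) ⟨
    length xs                      ≡⟨ length-map f xs ⟨
    length (map f xs)              ≤⟨ unique⇒length≤ N (map-unique f (Unique.filter⁺ P? (Unique.upTo⁺ M)) inRange
                                        (λ (a<M , Pa) (b<M , Pb) → inj a<M b<M Pa Pb))
                                        (All.map⁺ (All.map (λ (a<M , Pa) → f<N a<M Pa) inRange)) ⟩
    N                              ∎
  where
  open ≤-Reasoning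
  xs = filter P? (upTo M)
  inRange : All (λ a → a < M × P a) xs
  inRange = All.zip (All.filter⁺ P? (All.all-upTo M) , All.all-filter P? (upTo M))

[m*n+o]/n≡m : ∀ m {n o} .{{_ : NonZero n}} → o < n → (m * n + o) / n ≡ m
[m*n+o]/n≡m m {n} {o} o<n = begin
    (m * n + o) / n          ≡⟨ +-distrib-/ (m * n) o (subst (_< n) (sym remainders) o<n) ⟩
    m * n / n + o / n        ≡⟨ cong₂ _+_ (m*n/n≡m m n) (m<n⇒m/n≡0 o<n) ⟩
    m + 0                    ≡⟨ +-identityʳ m ⟩
    m                        ∎
  where
  open ≡-Reasoning
  remainders : (m * n) % n + o % n ≡ o
  remainders = cong₂ _+_ (m*n%n≡0 m n) (m<n⇒m%n≡m o<n)

SmallResidue : ℕ → ℕ → ℕ → ℕ → Set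
SmallResidue m n e a = modN m (a * e) ≢ 0 × n * modN m (a * e) < m

smallResidue? : ∀ m n e → Decidable (SmallResidue m n e)
smallResidue? m n e a = ¬? (modN m (a * e) ≟ 0) ×-dec (n * modN m (a * e) <? m)

-- With m = G M′ and e = G e′ (M′, e′ coprime) the residue a e mod m is a multiple s G of G, and two
-- a with the same residue differ by a multiple of M′; so a ↦ (s − 1) G + ⌊a / M′⌋ is injective on
-- small residues, with values below m / n.
module _ (m₀ n₀ e G M′ e′ : ℕ) .{{_ : NonZero G}} .{{_ : NonZero M′}}
         (m≡GM′ : suc m₀ ≡ G * M′) (e≡Ge′ : e ≡ G * e′) (cop : Coprime M′ e′) where

  private
    m = suc m₀
    n = suc n₀

    w : ℕ → ℕ
    w a = (a * e) % m

    G∣w : ∀ a → G ∣ w a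
    G∣w a = ∣m+n∣m⇒∣n (subst (G ∣_) (trans (m≡m%n+[m/n]*n (a * e) m) (+-comm (w a) _)) G∣ae)
                      (∣n⇒∣m*n ((a * e) / m) (subst (G ∣_) (sym m≡GM′) (m∣m*n M′)))
      where
      G∣ae : G ∣ a * e
      G∣ae = ∣n⇒∣m*n a (subst (G ∣_) (sym e≡Ge′) (m∣m*n e′))

    s : ℕ → ℕ
    s a = w a / G

    s*G≡w : ∀ a → s a * G ≡ w a
    s*G≡w a = m/n*n≡m (G∣w a)

    code : ℕ → ℕ
    code a = (s a ∸ 1) * G + a / M′

    s≥1 : ∀ {a} → SmallResidue m n e a → 1 ≤ s a
    s≥1 {a} (w≢0 , _) with s a | s*G≡w a
    ... | zero | 0≡w = ⊥-elim (w≢0 (sym 0≡w))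
    ... | suc _ | _ = s≤s z≤n

    a/M′<G : ∀ {a} → a < m → a / M′ < G
    a/M′<G {a} a<m = m<n*o⇒m/o<n (subst (a <_) m≡GM′ a<m)

    code<w : ∀ {a} → a < m → SmallResidue m n e a → code a < w a
    code<w {a} a<m small = begin
        suc ((s a ∸ 1) * G + a / M′)   ≡⟨ +-suc _ (a / M′) ⟨
        (s a ∸ 1) * G + suc (a / M′)   ≤⟨ +-monoʳ-≤ ((s a ∸ 1) * G) (a/M′<G a<m) ⟩
        (s a ∸ 1) * G + G              ≡⟨ +-comm _ G ⟩
        suc (s a ∸ 1) * G              ≡⟨ cong (_* G) (m+[n∸m]≡n (s≥1 {a} small)) ⟩
        s a * G                        ≡⟨ s*G≡w a ⟩
        w a                            ∎
      where open ≤-Reasoning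

    code<m/n : ∀ {a} → a < m → SmallResidue m n e a → code a < m / n
    code<m/n {a} a<m small = subst (_≤ m / n) (m*n/n≡m (suc (code a)) n) (/-monoˡ-≤ n (begin
        suc (code a) * n               ≡⟨ *-comm (suc (code a)) n ⟩
        n * suc (code a)               ≤⟨ *-monoʳ-≤ n (code<w {a} a<m small) ⟩
        n * w a                        ≤⟨ <⇒≤ (proj₂ small) ⟩
        m                              ∎))
      where open ≤-Reasoning

    sameResidue⇒M′∣ : ∀ {a b} → b ≤ a → w a ≡ w b → M′ ∣ a ∸ b
    sameResidue⇒M′∣ {a} {b} b≤a wa≡wb = coprime-divisor cop (divides (k₁ ∸ k₂) (*-cancelˡ-≡ _ _ G (begin
        G * (e′ * (a ∸ b))           ≡⟨ regroup′ G (a ∸ b) e′ ⟩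
        (a ∸ b) * (G * e′)           ≡⟨ cong ((a ∸ b) *_) e≡Ge′ ⟨
        (a ∸ b) * e                  ≡⟨ difference ⟩
        (k₁ ∸ k₂) * m                ≡⟨ cong ((k₁ ∸ k₂) *_) m≡GM′ ⟩
        (k₁ ∸ k₂) * (G * M′)         ≡⟨ regroup G (k₁ ∸ k₂) M′ ⟨
        G * ((k₁ ∸ k₂) * M′)         ∎)))
      where
      open ≡-Reasoning
      k₁ = (a * e) / m
      k₂ = (b * e) / m
      regroup : ∀ G x y → G * (x * y) ≡ x * (G * y)
      regroup = solve-∀
      regroup′ : ∀ G x y → G * (y * x) ≡ x * (G * y)
      regroup′ = solve-∀
      difference : (a ∸ b) * e ≡ (k₁ ∸ k₂) * m
      difference = begin
        (a ∸ b) * e                          ≡⟨ *-distribʳ-∸ e a b ⟩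
        a * e ∸ b * e                        ≡⟨ cong₂ _∸_ (m≡m%n+[m/n]*n (a * e) m) (m≡m%n+[m/n]*n (b * e) m) ⟩
        (w a + k₁ * m) ∸ (w b + k₂ * m)      ≡⟨ cong (λ x → (x + k₁ * m) ∸ (w b + k₂ * m)) wa≡wb ⟩
        (w b + k₁ * m) ∸ (w b + k₂ * m)      ≡⟨ [m+n]∸[m+o]≡n∸o (w b) (k₁ * m) (k₂ * m) ⟩
        k₁ * m ∸ k₂ * m                      ≡⟨ *-distribʳ-∸ m k₁ k₂ ⟨
        (k₁ ∸ k₂) * m                        ∎

    sameBlock⇒≡ : ∀ {a b} → b ≤ a → a / M′ ≡ b / M′ → w a ≡ w b → a ≡ b
    sameBlock⇒≡ {a} {b} b≤a a/M′≡ wa≡wb with sameResidue⇒M′∣ b≤a wa≡wb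
    ... | divides zero a∸b≡0 = trans (sym (m∸n+n≡m b≤a)) (cong (_+ b) a∸b≡0)
    ... | divides (suc t) a∸b≡ = ⊥-elim (<-irrefl (sym a/M′≡) (begin-strict
          b / M′                  <⟨ n<1+n _ ⟩
          suc (b / M′)            ≡⟨ cong (_+ b / M′) (n/n≡1 M′) ⟨
          M′ / M′ + b / M′        ≡⟨ +-distrib-/-∣ˡ b ∣-refl ⟨
          (M′ + b) / M′           ≤⟨ /-monoˡ-≤ M′ (subst (_≤ a) (+-comm b M′) b+M′≤a) ⟩
          a / M′                  ∎))
      where
      open ≤-Reasoning
      b+M′≤a : b + M′ ≤ a
      b+M′≤a = begin
        b + M′                  ≤⟨ +-monoʳ-≤ b (m≤m+n M′ (t * M′)) ⟩
        b + suc t * M′          ≡⟨ cong (b +_) a∸b≡ ⟨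
        b + (a ∸ b)             ≡⟨ m+[n∸m]≡n b≤a ⟩
        a                       ∎

    code-injective : ∀ {a b} → a < m → b < m → SmallResidue m n e a → SmallResidue m n e b →
      code a ≡ code b → a ≡ b
    code-injective {a} {b} a<m b<m sa sb code≡ =
      [ (λ b≤a → sameBlock⇒≡ b≤a block≡ w≡) , (λ a≤b → sym (sameBlock⇒≡ a≤b (sym block≡) (sym w≡))) ]′ (≤-total b a)
      where
      s∸1≡ : s a ∸ 1 ≡ s b ∸ 1
      s∸1≡ = begin
        s a ∸ 1                                    ≡⟨ [m*n+o]/n≡m (s a ∸ 1) (a/M′<G a<m) ⟨
        ((s a ∸ 1) * G + a / M′) / G               ≡⟨ cong (_/ G) code≡ ⟩
        ((s b ∸ 1) * G + b / M′) / G               ≡⟨ [m*n+o]/n≡m (s b ∸ 1) (a/M′<G b<m) ⟩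
        s b ∸ 1                                    ∎
        where open ≡-Reasoning
      block≡ : a / M′ ≡ b / M′
      block≡ = +-cancelˡ-≡ ((s a ∸ 1) * G) _ _ (trans code≡ (cong (λ x → x * G + b / M′) (sym s∸1≡)))
      w≡ : w a ≡ w b
      w≡ = begin
        w a                          ≡⟨ s*G≡w a ⟨
        s a * G                      ≡⟨ cong (_* G) (trans (sym (m+[n∸m]≡n (s≥1 {a} sa))) (trans (cong suc s∸1≡) (m+[n∸m]≡n (s≥1 {b} sb)))) ⟩
        s b * G                      ≡⟨ s*G≡w b ⟩
        w b                          ∎
        where open ≡-Reasoning

  #smallResidues≤-coprime : n * Σ< (𝟙 ∘ smallResidue? m n e) m ≤ m
  #smallResidues≤-coprime = begin
      n * Σ< (𝟙 ∘ smallResidue? m n e) m  ≤⟨ *-monoʳ-≤ n (#≤-injection (smallResidue? m n e) m (m / n) code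
                                                (λ {a} → code<m/n {a}) (λ {a} {b} → code-injective {a} {b})) ⟩
      n * (m / n)                          ≡⟨ *-comm n (m / n) ⟩
      m / n * n                            ≤⟨ m/n*n≤m m n ⟩
      m                                    ∎
    where open ≤-Reasoning

#smallResidues≤ : ∀ m₀ n₀ e → suc n₀ * Σ< (𝟙 ∘ smallResidue? (suc m₀) (suc n₀) e) (suc m₀) ≤ suc m₀
#smallResidues≤ m₀ n₀ e =
  #smallResidues≤-coprime m₀ n₀ e G M′ (e / G) (sym (m*[n/m]≡n G∣m)) (sym (m*[n/m]≡n G∣e)) (coprime-/gcd m e)
  where
  m = suc m₀
  G = gcd m e
  G∣m = gcd[m,n]∣m m e
  G∣e = gcd[m,n]∣n m e
  instance
    G≢0 : NonZero G
    G≢0 = ≢-nonZero (gcd[m,n]≢0 m e (inj₁ λ ()))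
  M′ = m / G
  instance
    M′≢0 : NonZero M′
    M′≢0 = ≢-nonZero (λ M′≡0 → 1+n≢0 (trans (sym (m*[n/m]≡n G∣m)) (trans (cong (G *_) M′≡0) (*-zeroʳ G))))

-- Collisions of multiplicative hashing

module _ (m₀ : ℕ) where

  private
    m = suc m₀

  sameQuotient⇒< : ∀ A B → A / m ≡ B / m → A < B + m
  sameQuotient⇒< A B A/m≡B/m = begin-strict
      A                    ≡⟨ m≡m%n+[m/n]*n A m ⟩
      A % m + A / m * m    <⟨ +-monoˡ-< (A / m * m) (m%n<n A m) ⟩
      m + A / m * m        ≡⟨ cong (λ q → m + q * m) A/m≡B/m ⟩
      m + B / m * m        ≤⟨ +-monoʳ-≤ m (m/n*n≤m B m) ⟩
      m + B                ≡⟨ +-comm m B ⟩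
      B + m                ∎
    where open ≤-Reasoning

  residue≢0 : ∀ {a d} → Coprime a m → 1 ≤ d → d < m → (a * d) % m ≢ 0
  residue≢0 {a} {d} a⊥m d≥1 d<m ad%m≡0 =
    <⇒≱ d<m (∣⇒≤′ d≥1 (coprime-divisor (Coprime.sym a⊥m) (m%n≡0⇒n∣m (a * d) m ad%m≡0)))

  residue+residue≡m : ∀ {a d} → Coprime a m → 1 ≤ d → d < m → (a * d) % m + (a * (m ∸ d)) % m ≡ m
  residue+residue≡m {a} {d} a⊥m d≥1 d<m with m%n≡0⇒n∣m (w + w′) m (begin
      (w + w′) % m                 ≡⟨ %-distribˡ-+ (a * d) (a * (m ∸ d)) m ⟨
      (a * d + a * (m ∸ d)) % m    ≡⟨ cong (_% m) (*-distribˡ-+ a d (m ∸ d)) ⟨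
      (a * (d + (m ∸ d))) % m      ≡⟨ cong (λ k → (a * k) % m) (m+[n∸m]≡n (<⇒≤ d<m)) ⟩
      (a * m) % m                  ≡⟨ m*n%n≡0 a m ⟩
      0                            ∎)
    where
    open ≡-Reasoning
    w = (a * d) % m
    w′ = (a * (m ∸ d)) % m
  ... | divides zero w+w′≡0 = ⊥-elim (residue≢0 a⊥m d≥1 d<m (m+n≡0⇒m≡0 _ w+w′≡0))
  ... | divides 1 w+w′≡m = trans w+w′≡m (+-identityʳ m)
  ... | divides (suc (suc k)) w+w′≡ = ⊥-elim (<⇒≱ (+-mono-< (m%n<n (a * d) m) (m%n<n (a * (m ∸ d)) m))
          (subst (m + m ≤_) (sym w+w′≡) (+-monoʳ-≤ m (m≤m+n m (k * m)))))

  collision⇒smallResidue : ∀ n a y d → 1 ≤ d → d < m → Coprime a m →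
    bin m n a (y + d) ≡ bin m n a y → SmallResidue m n d a ⊎ SmallResidue m n (m ∸ d) a
  collision⇒smallResidue n a y d d≥1 d<m a⊥m sameBin = cases (v + w <? m)
    where
    u = (a * (y + d)) % m
    v = (a * y) % m
    w = (a * d) % m
    w′ = (a * (m ∸ d)) % m
    u≡ : u ≡ (v + w) % m
    u≡ = trans (cong (_% m) (*-distribˡ-+ a y d)) (%-distribˡ-+ (a * y) (a * d) m)
    w+w′≡m : w + w′ ≡ m
    w+w′≡m = residue+residue≡m a⊥m d≥1 d<m
    cases : Dec (v + w < m) → SmallResidue m n d a ⊎ SmallResidue m n (m ∸ d) a
    cases (yes v+w<m) = inj₁ (residue≢0 a⊥m d≥1 d<m , +-cancelˡ-< (n * v) (n * w) m (subst (_< n * v + m) nu≡ nu<nv+m))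
      where
      nu<nv+m = sameQuotient⇒< (n * u) (n * v) sameBin
      nu≡ : n * u ≡ n * v + n * w
      nu≡ = trans (cong (n *_) (trans u≡ (m<n⇒m%n≡m v+w<m))) (*-distribˡ-+ n v w)
    cases (no v+w≮m) = inj₂ (w′≢0 , +-cancelˡ-< (n * u) (n * w′) m (subst (_< n * u + m) nv≡ nv<nu+m))
      where
      nv<nu+m = sameQuotient⇒< (n * v) (n * u) (sym sameBin)
      m≤v+w : m ≤ v + w
      m≤v+w = ≮⇒≥ v+w≮m
      u≡v+w∸m : u ≡ v + w ∸ m
      u≡v+w∸m = trans u≡ (trans (sym (m≤n⇒[n∸m]%m≡n%m m≤v+w)) (m<n⇒m%n≡m (+-cancelʳ-< m (v + w ∸ m) m
                  (subst (_< m + m) (sym (m∸n+n≡m m≤v+w)) (+-mono-< (m%n<n (a * y) m) (m%n<n (a * d) m))))))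
      u+w′≡v : u + w′ ≡ v
      u+w′≡v = +-cancelʳ-≡ w (u + w′) v (begin
          u + w′ + w          ≡⟨ +-assoc u w′ w ⟩
          u + (w′ + w)        ≡⟨ cong (u +_) (trans (+-comm w′ w) w+w′≡m) ⟩
          u + m               ≡⟨ cong (_+ m) u≡v+w∸m ⟩
          v + w ∸ m + m       ≡⟨ m∸n+n≡m m≤v+w ⟩
          v + w               ∎)
        where open ≡-Reasoning
      nv≡ : n * v ≡ n * u + n * w′
      nv≡ = trans (cong (n *_) (sym u+w′≡v)) (*-distribˡ-+ n u w′)
      w′≢0 : w′ ≢ 0
      w′≢0 w′≡0 = <⇒≢ (m%n<n (a * d) m) (trans (sym (+-identityʳ w)) (trans (cong (w +_) (sym w′≡0)) w+w′≡m))

collisions : ℕ → ℕ → ℕ → ℕ → ℕ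
collisions m n x y = Σl (λ a → 𝟙 (bin m n a x ≟ bin m n a y)) (units m)

collisions-sym : ∀ m n x y → collisions m n x y ≡ collisions m n y x
collisions-sym m n x y = Σl-cong (units m) (λ a → 𝟙-cong (bin m n a x ≟ bin m n a y) (bin m n a y ≟ bin m n a x) sym sym)

collisions≡Σ< : ∀ m n x y → collisions m n x y ≡ Σ< (λ a → 𝟙 (coprime? a m) * 𝟙 (bin m n a x ≟ bin m n a y)) m
collisions≡Σ< m n x y = trans (Σl-filter (λ k → coprime? k m) _ (upTo m)) (Σl-upTo _ m)

n*collisions[y+d,y]≤2m : ∀ m₀ n₀ y d → 1 ≤ d → d < suc m₀ → suc n₀ * collisions (suc m₀) (suc n₀) (y + d) y ≤ 2 * suc m₀
n*collisions[y+d,y]≤2m m₀ n₀ y d d≥1 d<m = begin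
    n * collisions m n (y + d) y             ≡⟨ cong (n *_) (collisions≡Σ< m n (y + d) y) ⟩
    n * Σ< (λ a → 𝟙 (coprime? a m) * 𝟙 (bin m n a (y + d) ≟ bin m n a y)) m
                                             ≤⟨ *-monoʳ-≤ n (Σ<-mono-≤ m (λ a _ → termwise a)) ⟩
    n * Σ< (λ a → small d a + small (m ∸ d) a) m
                                             ≡⟨ cong (n *_) (Σ<-distrib-+ (small d) (small (m ∸ d)) m) ⟩
    n * (Σ< (small d) m + Σ< (small (m ∸ d)) m)
                                             ≡⟨ *-distribˡ-+ n (Σ< (small d) m) (Σ< (small (m ∸ d)) m) ⟩
    n * Σ< (small d) m + n * Σ< (small (m ∸ d)) m
                                             ≤⟨ +-mono-≤ (#smallResidues≤ m₀ n₀ d) (#smallResidues≤ m₀ n₀ (m ∸ d)) ⟩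
    m + m                                    ≡⟨ cong (m +_) (+-identityʳ m) ⟨
    2 * m                                    ∎
  where
  open ≤-Reasoning
  m = suc m₀
  n = suc n₀
  small : ℕ → ℕ → ℕ
  small e = 𝟙 ∘ smallResidue? m n e
  termwise : ∀ a → 𝟙 (coprime? a m) * 𝟙 (bin m n a (y + d) ≟ bin m n a y) ≤ small d a + small (m ∸ d) a
  termwise a with coprime? a m | bin m n a (y + d) ≟ bin m n a y
  ... | no _ | _ = z≤n
  ... | yes _ | no _ = z≤n
  ... | yes a⊥m | yes sameBin with collision⇒smallResidue m₀ n a y d d≥1 d<m a⊥m sameBin
  ...   | inj₁ sd = ≤-trans (s≤s z≤n) (≤-reflexive (sym (cong (_+ small (m ∸ d) a) (𝟙-yes (smallResidue? m n d a) sd))))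
  ...   | inj₂ sm∸d = ≤-trans (s≤s z≤n) (≤-trans (≤-reflexive (sym (𝟙-yes (smallResidue? m n (m ∸ d) a) sm∸d))) (m≤n+m _ _))

n*collisions≤2m : ∀ m₀ n₀ x y → x < suc m₀ → y < suc m₀ → x ≢ y → suc n₀ * collisions (suc m₀) (suc n₀) x y ≤ 2 * suc m₀
n*collisions≤2m m₀ n₀ x y x<m y<m x≢y with <-cmp x y
... | tri≈ _ x≡y _ = ⊥-elim (x≢y x≡y)
... | tri> _ _ y<x = subst (λ z → suc n₀ * collisions (suc m₀) (suc n₀) z y ≤ 2 * suc m₀) (m+[n∸m]≡n (<⇒≤ y<x))
        (n*collisions[y+d,y]≤2m m₀ n₀ y (x ∸ y) (m<n⇒0<n∸m y<x) (≤-trans (s≤s (m∸n≤m x y)) x<m))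
... | tri< x<y _ _ = subst (_≤ 2 * suc m₀) (cong (suc n₀ *_) (collisions-sym (suc m₀) (suc n₀) y x))
        (subst (λ z → suc n₀ * collisions (suc m₀) (suc n₀) z x ≤ 2 * suc m₀) (m+[n∸m]≡n (<⇒≤ x<y))
          (n*collisions[y+d,y]≤2m m₀ n₀ x (y ∸ x) (m<n⇒0<n∸m x<y) (≤-trans (s≤s (m∸n≤m y x)) y<m)))

collidingPairs : ℕ → ℕ → ℕ → List ℕ → ℕ
collidingPairs m n a X = Σl (λ x → Σl (λ y → 𝟙 (bin m n a x ≟ bin m n a y)) X) X

load²≤collidingPairs : ∀ m n a X b → load m n a X b * load m n a X b ≤ collidingPairs m n a X
load²≤collidingPairs m n a X b = begin
    load m n a X b * load m n a X b               ≡⟨ cong (_* load m n a X b) (length-filter (λ x → bin m n a x ≟ b) X) ⟩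
    Σl (λ x → 𝟙 (bin m n a x ≟ b)) X * L          ≡⟨ Σl-*ʳ _ L X ⟩
    Σl (λ x → 𝟙 (bin m n a x ≟ b) * L) X          ≤⟨ Σl-mono-≤ X row ⟩
    collidingPairs m n a X                        ∎
  where
  open ≤-Reasoning
  L = load m n a X b
  row : ∀ x → 𝟙 (bin m n a x ≟ b) * L ≤ Σl (λ y → 𝟙 (bin m n a x ≟ bin m n a y)) X
  row x with bin m n a x ≟ b
  ... | no _ = z≤n
  ... | yes x∈b = ≤-reflexive (trans (*-identityˡ L) (trans (length-filter (λ x → bin m n a x ≟ b) X)
        (Σl-cong X (λ y → 𝟙-cong (bin m n a y ≟ b) (bin m n a x ≟ bin m n a y)
                             (λ y∈b → trans x∈b (sym y∈b)) (λ same → trans (sym same) x∈b)))))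

max²≤ : ∀ (f : ℕ → ℕ) C xs → (∀ b → f b * f b ≤ C) → foldr _⊔_ 0 (map f xs) * foldr _⊔_ 0 (map f xs) ≤ C
max²≤ f C [] _ = z≤n
max²≤ f C (x ∷ xs) f²≤C with ⊔-sel (f x) (foldr _⊔_ 0 (map f xs))
... | inj₁ max≡fx = subst (λ k → k * k ≤ C) (sym max≡fx) (f²≤C x)
... | inj₂ max≡rest = subst (λ k → k * k ≤ C) (sym max≡rest) (max²≤ f C xs f²≤C)

maxload²≤collidingPairs : ∀ m n a X → maxload m n a X * maxload m n a X ≤ collidingPairs m n a X
maxload²≤collidingPairs m n a X = max²≤ (load m n a X) (collidingPairs m n a X) (upTo n) (load²≤collidingPairs m n a X)

Σcollisions≤ : ∀ m₀ n₀ {X} x → Unique X → All (_< suc m₀) X → length X ≡ suc n₀ → x < suc m₀ →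
  Σl (collisions (suc m₀) (suc n₀) x) X ≤ φ (suc m₀) + 2 * suc m₀
Σcollisions≤ m₀ n₀ {X} x uniq X<m |X|≡n x<m = begin
    Σl (collisions m n x) X                                   ≤⟨ Σl-mono-≤ X diagonal ⟩
    Σl (λ y → 𝟙 (y ≟ x) * φ m + 𝟙 (¬? (y ≟ x)) * collisions m n x y) X
                                                              ≡⟨ Σl-distrib-+ _ _ X ⟩
    Σl (λ y → 𝟙 (y ≟ x) * φ m) X + Σl (λ y → 𝟙 (¬? (y ≟ x)) * collisions m n x y) X
                                                              ≤⟨ +-mono-≤ onDiagonal offDiagonal ⟩
    φ m + 2 * m                                               ∎
  where
  open ≤-Reasoning
  m = suc m₀
  n = suc n₀
  collisions≤φ : ∀ y → collisions m n x y ≤ φ m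
  collisions≤φ y = ≤-trans (Σl-mono-≤ (units m) (λ a → 𝟙≤1 (bin m n a x ≟ bin m n a y)))
                     (≤-reflexive (trans (Σl-const 1 (units m)) (*-identityʳ _)))
  diagonal : ∀ y → collisions m n x y ≤ 𝟙 (y ≟ x) * φ m + 𝟙 (¬? (y ≟ x)) * collisions m n x y
  diagonal y with y ≟ x
  ... | yes refl = ≤-trans (collisions≤φ y) (≤-reflexive (sym (trans (+-identityʳ _) (*-identityˡ (φ m)))))
  ... | no _ = ≤-reflexive (sym (*-identityˡ _))
  onDiagonal : Σl (λ y → 𝟙 (y ≟ x) * φ m) X ≤ φ m
  onDiagonal = begin
    Σl (λ y → 𝟙 (y ≟ x) * φ m) X      ≡⟨ Σl-*ʳ (λ y → 𝟙 (y ≟ x)) (φ m) X ⟨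
    Σl (λ y → 𝟙 (y ≟ x)) X * φ m      ≤⟨ *-monoˡ-≤ (φ m) (unique⇒#occurrences≤1 x uniq) ⟩
    1 * φ m                           ≡⟨ *-identityˡ (φ m) ⟩
    φ m                               ∎
  offDiagonal : Σl (λ y → 𝟙 (¬? (y ≟ x)) * collisions m n x y) X ≤ 2 * m
  offDiagonal = *-cancelʳ-≤′ _ (2 * m) n (s≤s z≤n) (begin
    Σl (λ y → 𝟙 (¬? (y ≟ x)) * collisions m n x y) X * n     ≡⟨ Σl-*ʳ _ n X ⟩
    Σl (λ y → 𝟙 (¬? (y ≟ x)) * collisions m n x y * n) X     ≤⟨ Σl-All-mono-≤ {xs = X} (All.map term≤ X<m) ⟩
    Σl (λ _ → 2 * m) X                                        ≡⟨ Σl-const (2 * m) X ⟩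
    length X * (2 * m)                                        ≡⟨ cong (_* (2 * m)) |X|≡n ⟩
    n * (2 * m)                                               ≡⟨ *-comm n (2 * m) ⟩
    2 * m * n                                                 ∎)
    where
    term≤ : ∀ {y} → y < m → 𝟙 (¬? (y ≟ x)) * collisions m n x y * n ≤ 2 * m
    term≤ {y} y<m with y ≟ x
    ... | yes _ = z≤n
    ... | no y≢x = ≤-trans (≤-reflexive (trans (cong (_* n) (*-identityˡ (collisions m n x y))) (*-comm (collisions m n x y) n)))
                     (n*collisions≤2m m₀ n₀ x y x<m y<m (y≢x ∘ sym))

totalMaxload²≤ : ∀ m₀ n₀ X → Unique X → All (_< suc m₀) X → length X ≡ suc n₀ →
  totalMaxload (suc m₀) (suc n₀) X * totalMaxload (suc m₀) (suc n₀) X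
    ≤ φ (suc m₀) * (suc n₀ * (φ (suc m₀) + 2 * suc m₀))
totalMaxload²≤ m₀ n₀ X uniq X<m |X|≡n = begin
    T * T                                        ≡⟨ cong₂ _*_ T≡ T≡ ⟩
    Σl M (units m) * Σl M (units m)              ≤⟨ cauchy-schwarz M (units m) ⟩
    φ m * Σl (λ a → M a * M a) (units m)         ≤⟨ *-monoʳ-≤ (φ m) (Σl-mono-≤ (units m) (λ a → maxload²≤collidingPairs m n a X)) ⟩
    φ m * Σl (λ a → collidingPairs m n a X) (units m)
                                                 ≡⟨ cong (φ m *_) byPairs ⟩
    φ m * Σl (λ x → Σl (collisions m n x) X) X   ≤⟨ *-monoʳ-≤ (φ m) (Σl-All-mono-≤ {xs = X} (All.map (λ {x} → Σcollisions≤ m₀ n₀ x uniq X<m |X|≡n) X<m)) ⟩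
    φ m * Σl (λ _ → φ m + 2 * m) X               ≡⟨ cong (φ m *_) (trans (Σl-const _ X) (cong (_* (φ m + 2 * m)) |X|≡n)) ⟩
    φ m * (n * (φ m + 2 * m))                    ∎
  where
  open ≤-Reasoning
  m = suc m₀
  n = suc n₀
  M = λ a → maxload m n a X
  T = totalMaxload m n X
  T≡ : T ≡ Σl M (units m)
  T≡ = sum-map M (units m)
  byPairs : Σl (λ a → collidingPairs m n a X) (units m) ≡ Σl (λ x → Σl (collisions m n x) X) X
  byPairs = trans (Σl-comm (λ a x → Σl (λ y → 𝟙 (bin m n a x ≟ bin m n a y)) X) (units m) X)
              (Σl-cong X (λ x → Σl-comm (λ a y → 𝟙 (bin m n a x ≟ bin m n a y)) (units m) X))

-- Choice of constants

n^C≤2^2^[1+loglog[n]+C] : ∀ n C → n ^ C ≤ 2 ^ 2 ^ (suc (loglog n) + C)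
n^C≤2^2^[1+loglog[n]+C] n C = begin
    n ^ C                             ≤⟨ ^-monoˡ-≤ C (<⇒≤ (n<2^[1+⌊log₂n⌋] n)) ⟩
    (2 ^ suc ℓ) ^ C                   ≡⟨ ^-*-assoc 2 (suc ℓ) C ⟩
    2 ^ (suc ℓ * C)                   ≤⟨ ^-monoʳ-≤ 2 (*-mono-≤ (n<2^[1+⌊log₂n⌋] ℓ) (<⇒≤ (n<2^n C))) ⟩
    2 ^ (2 ^ suc (loglog n) * 2 ^ C)  ≡⟨ cong (2 ^_) (^-distribˡ-+-* 2 (suc (loglog n)) C) ⟨
    2 ^ 2 ^ (suc (loglog n) + C)      ∎
  where
  open ≤-Reasoning
  ℓ = ⌊log₂ n ⌋

loglog≥1 : ∀ {n} → 4 ≤ n → 1 ≤ loglog n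
loglog≥1 {n} n≥4 = 2^m≤n⇒m≤⌊log₂n⌋ 1 ⌊log₂ n ⌋ (2^m≤n⇒m≤⌊log₂n⌋ 2 n n≥4)

m≤K*loglog[n]*φ[m] : ∀ C n m → 4 ≤ n → 1 ≤ m → m ≤ n ^ C → m ≤ 4 * (8 * C + 21) * loglog n * φ m
m≤K*loglog[n]*φ[m] C n m n≥4 m≥1 m≤n^C = begin
    m                                  ≤⟨ totient-lower-bound J m (s≤s z≤n) m≥1 (≤-trans m≤n^C (n^C≤2^2^[1+loglog[n]+C] n C)) ⟩
    4 * (8 * J + 5) * φ m              ≤⟨ *-monoˡ-≤ (φ m) constant≤ ⟩
    4 * (8 * C + 21) * L * φ m         ∎
  where
  open ≤-Reasoning
  L = loglog n
  J = suc L + C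
  constant≤ : 4 * (8 * J + 5) ≤ 4 * (8 * C + 21) * L
  constant≤ with L | loglog≥1 n≥4
  ... | suc L′ | _ = subst (4 * (8 * (suc (suc L′) + C) + 5) ≤_) (sym (split C L′)) (m≤m+n _ _)
    where
    split : ∀ C L′ → 4 * (8 * C + 21) * suc L′ ≡ 4 * (8 * (suc (suc L′) + C) + 5) + 4 * (8 * C * L′ + 13 * L′)
    split = solve-∀

totalMaxload²≤K*n*loglog[n]*φ[m]² : ∀ C m₀ n₀ X → 4 ≤ suc n₀ → suc m₀ ≤ suc n₀ ^ C →
  Unique X → All (_< suc m₀) X → length X ≡ suc n₀ →
  totalMaxload (suc m₀) (suc n₀) X * totalMaxload (suc m₀) (suc n₀) X
    ≤ (1 + 2 * (4 * (8 * C + 21))) * suc n₀ * loglog (suc n₀) * (φ (suc m₀) * φ (suc m₀))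
totalMaxload²≤K*n*loglog[n]*φ[m]² C m₀ n₀ X n≥4 m≤n^C uniq X<m |X|≡n = begin
    T * T                                  ≤⟨ totalMaxload²≤ m₀ n₀ X uniq X<m |X|≡n ⟩
    U * (n * (U + 2 * m))                  ≤⟨ *-monoʳ-≤ U (*-monoʳ-≤ n (+-monoʳ-≤ U (*-monoʳ-≤ 2
                                                 (m≤K*loglog[n]*φ[m] C n m n≥4 (s≤s z≤n) m≤n^C)))) ⟩
    U * (n * (U + 2 * (K * L * U)))        ≡⟨ expand U n K L ⟩
    n * (U * U) + 2 * K * n * (L * (U * U))
                                           ≤⟨ +-monoˡ-≤ _ (*-monoʳ-≤ n (m≤n*m (U * U) L {{>-nonZero (loglog≥1 n≥4)}})) ⟩
    n * (L * (U * U)) + 2 * K * n * (L * (U * U))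
                                           ≡⟨ collect n L U K ⟩
    (1 + 2 * K) * n * L * (U * U)          ∎
  where
  open ≤-Reasoning
  m = suc m₀
  n = suc n₀
  K = 4 * (8 * C + 21)
  T = totalMaxload m n X
  U = φ m
  L = loglog n
  expand : ∀ U n K L → U * (n * (U + 2 * (K * L * U))) ≡ n * (U * U) + 2 * K * n * (L * (U * U))
  expand = solve-∀
  collect : ∀ n L U K → n * (L * (U * U)) + 2 * K * n * (L * (U * U)) ≡ (1 + 2 * K) * n * L * (U * U)
  collect = solve-∀

mainTheorem8 : (C : ℕ) → ∃[ K ] ∃[ N ] ((n m : ℕ) → N ≤ n → n ^ 6 ≤ m → m ≤ n ^ C →
    (X : List ℕ) → Unique X → All (_< m) X → length X ≡ n →
    totalMaxload m n X ^ 2 ≤ K * n * loglog n * length (units m) ^ 2)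
mainTheorem8 C = K , 4 , bound
  where
  K = 1 + 2 * (4 * (8 * C + 21))
  bound : (n m : ℕ) → 4 ≤ n → n ^ 6 ≤ m → m ≤ n ^ C →
    (X : List ℕ) → Unique X → All (_< m) X → length X ≡ n →
    totalMaxload m n X ^ 2 ≤ K * n * loglog n * length (units m) ^ 2
  bound (suc n₀) zero _ n⁶≤0 _ _ _ _ _ = ⊥-elim (<⇒≱ (m^n>0 (suc n₀) 6) n⁶≤0)
  bound n@(suc n₀) m@(suc m₀) n≥4 _ m≤n^C X uniq X<m |X|≡n =
    subst₂ _≤_ (square (totalMaxload m n X)) (cong (K * n * loglog n *_) (square (φ m)))
      (totalMaxload²≤K*n*loglog[n]*φ[m]² C m₀ n₀ X n≥4 m≤n^C uniq X<m |X|≡n)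
    where
    square : ∀ x → x * x ≡ x ^ 2
    square x = cong (x *_) (sym (*-identityʳ x))
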